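{- Let $n,k$ be positive integers with $k\le n$. For every $l\in\{1,\dots,k\}$, $$\sum_{\pi\in\mathcal P_n^k} q^{\mathrm{mak}_l(\pi)}=S_q(n,k).$$
   Context: For positive integers $n,k$, $\mathcal P_n^k$ denotes the set of set partitions of $[n]=\{1,\dots,n\}$ into $k$ blocks, written $\pi=B_1-B_2-\cdots-B_k$ with the blocks listed in increasing order of their smallest elements. For $\pi\in\mathcal P_n^k$ let $w(\pi)=w_1\cdots w_n$, where $w_i$ is the index $j$ of the block $B_j$ containing $i$. The openers $\mathcal O(\pi)$ are the smallest elements of the blocks, and the closers $\mathcal F(\pi)$ are the largest elements of the blocks. For $i\in[n]$ set $\mathrm{ros}_i(\pi)=\#\{j\in\mathcal O(\pi): j<i,\ w_j>w_i\}$ and $\mathrm{lcs}_i(\pi)=\#\{j\in\mathcal F(\pi): j<i,\ w_j<w_i\}$. Then $\mathrm{ros}(\pi)=\sum_i\mathrm{ros}_i(\pi)$, $\mathrm{lcs}(\pi)=\sum_i \mathrm{lcs}_i(\pi)$, and $\mathrm{mak}(\pi)=\mathrm{ros}(\pi)+\mathrm{lcs}(\pi)$. For $b\in[n]$ let $\mathrm{nrinv}(b,\pi)=\#\{a\in[n]: w_a>w_b \text{ and } a>b\}$. For $l\in[k]$ let $g(B_l)$ be the largest element of $B_l$, and define $\mathrm{mak}_l(\pi)=\mathrm{mak}(\pi)-\mathrm{nrinv}(g(B_l),\pi)+k-l$. The $q$-Stirling numbers of the second kind $S_q(n,k)$ are defined by $S_q(n,k)=q^{k-1}S_q(n-1,k-1)+[k]_qS_q(n-1,k)$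 for $1\le k\le n$, and $S_q(n,k)=\delta_{nk}$ if $n=0$ or $k=0$. Here $[k]_q=1+q+\cdots+q^{k-1}$. -}

module Defs where

open import Level using (Level)
open import Data.Bool using (Bool; true; false; _∧_; if_then_else_; not)
open import Data.Nat using (ℕ; zero; suc; _+_; _∸_; _≡ᵇ_; _<ᵇ_; _⊔_)
open import Data.List using (List; []; _∷_; length; map; concatMap; upTo; foldl; foldr)
open import Data.Nat.ListAction using (sum)
open import Algebra.Bundles using (CommutativeSemiring)

-- A set partition π ∈ P_n^k is represented by its word
-- w(π) = w_1 ⋯ w_n, stored as a list of length n.  Positions are
-- 0-indexed internally (position i here is element i+1 of [n]);
-- block labels are 1..k as in the paper.

at : List ℕ → ℕ → ℕ
at []       _       = 0
at (x ∷ xs) zero    = x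
at (x ∷ xs) (suc i) = at xs i

countᵇ : (ℕ → Bool) → List ℕ → ℕ
countᵇ p []       = 0
countᵇ p (x ∷ xs) = (if p x then 1 else 0) + countᵇ p xs

after : ℕ → ℕ → List ℕ
after n j = Data.List.drop (suc j) (upTo n)

maxL : List ℕ → ℕ
maxL = foldr _⊔_ 0

-- The words of set partitions of [n] into k blocks (blocks listed by
-- increasing smallest element): restricted growth words,
-- w_1 = 1, 1 ≤ w_i ≤ 1 + max(w_1..w_{i-1}), max w = k.

allWords : ℕ → ℕ → List (List ℕ)
allWords zero    k = [] ∷ []
allWords (suc n) k = concatMap (λ a → map (suc a ∷_) (allWords n k)) (upTo k)

isRGFfrom : ℕ → List ℕ → Bool
isRGFfrom m []       = true
isRGFfrom m (x ∷ xs) = (0 <ᵇ x) ∧ (x <ᵇ suc (suc m)) ∧ isRGFfrom (m ⊔ x) xs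

isPartitionWord : ℕ → List ℕ → Bool
isPartitionWord k w = isRGFfrom 0 w ∧ (maxL w ≡ᵇ k)

filterᵇ' : {A : Set} → (A → Bool) → List A → List A
filterᵇ' p []       = []
filterᵇ' p (x ∷ xs) = if p x then x ∷ filterᵇ' p xs else filterᵇ' p xs

partitions : ℕ → ℕ → List (List ℕ)
partitions n k = filterᵇ' (isPartitionWord k) (allWords n k)

isOpener : List ℕ → ℕ → Bool
isOpener w j = countᵇ (λ i → at w i ≡ᵇ at w j) (upTo j) ≡ᵇ 0

isCloser : List ℕ → ℕ → Bool
isCloser w j = countᵇ (λ i → at w i ≡ᵇ at w j) (after (length w) j) ≡ᵇ 0

rosAt : List ℕ → ℕ → ℕ
rosAt w i = countᵇ (λ j → isOpener w j ∧ (at w i <ᵇ at w j)) (upTo i)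

lcsAt : List ℕ → ℕ → ℕ
lcsAt w i = countᵇ (λ j → isCloser w j ∧ (at w j <ᵇ at w i)) (upTo i)

ros : List ℕ → ℕ
ros w = sum (map (rosAt w) (upTo (length w)))

lcs : List ℕ → ℕ
lcs w = sum (map (lcsAt w) (upTo (length w)))

mak : List ℕ → ℕ
mak w = ros w + lcs w

nrinv : List ℕ → ℕ → ℕ
nrinv w b = countᵇ (λ a → (b <ᵇ a) ∧ (at w b <ᵇ at w a)) (upTo (length w))

largestIn : List ℕ → ℕ → ℕ
largestIn w l = foldl (λ acc i → if at w i ≡ᵇ l then i else acc) 0 (upTo (length w))

-- mak_l(π) = mak(π) − nrinv(g(B_l), π) + k − l
-- (truncated subtraction is harmless: nrinv(g(B_l)) ≤ lcs(π) and l ≤ k)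
makₗ : ℕ → ℕ → List ℕ → ℕ
makₗ k l w = (mak w ∸ nrinv w (largestIn w l)) + (k ∸ l)

-- q-arithmetic in an arbitrary commutative semiring (q is an arbitrary
-- element; the identity for all such q is the polynomial identity).

module QArith {c ℓ : Level} (R : CommutativeSemiring c ℓ) where
  open CommutativeSemiring R using (Carrier; 0#; 1#) renaming (_+_ to _⊕_; _*_ to _⊗_)

  pow : Carrier → ℕ → Carrier
  pow q zero    = 1#
  pow q (suc m) = q ⊗ pow q m

  sumR : List Carrier → Carrier
  sumR = foldr _⊕_ 0#

  qInt : Carrier → ℕ → Carrier
  qInt q k = sumR (map (pow q) (upTo k))

  Sq : Carrier → ℕ → ℕ → Carrier
  Sq q zero    zero    = 1#
  Sq q zero    (suc k) = 0#
  Sq q (suc n) zero    = 0#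
  Sq q (suc n) (suc k) = pow q k ⊗ Sq q n k ⊕ qInt q (suc k) ⊗ Sq q n (suc k)

  makGen : Carrier → ℕ → ℕ → ℕ → Carrier
  makGen q n k l = sumR (map (λ w → pow q (makₗ k l w)) (partitions n k))

-- Build a partition word letter by letter: each step opens a new block k+1 or appends one of
-- the blocks 1, …, k. Opening raises mak by k; appending to block a raises it by k − 1 minus the
-- nrinv of the previous last element of block a, and lcs is the sum over blocks of nrinv at their
-- closers. So for any set T of blocks, mak + Σ_{b ∈ T} (k − b) − Σ_{b ∈ T} nrinv(g(B_b)) obeys a
-- subtraction-free recursion: appending to block i+1 adds an increment and replaces T by
-- T ∪ {i+1}, and for fixed T the increments for i = 0, …, k−1 are a permutation of 0, …, k−1.
-- Hence for every T the generating function satisfies S_q(n,k) = q^{k−1} S_q(n−1,k−1) +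
-- [k]_q S_q(n−1,k); T = {l} gives mak_l.

module Submission where

open import Defs
open import Level using (Level)
open import Algebra.Bundles using (CommutativeSemiring)
open import Data.Bool using (Bool; true; false; _∧_; _∨_; not; if_then_else_)
open import Data.List using (List; []; _∷_; _++_; _∷ʳ_; length; map; upTo; concatMap)
open import Data.Nat using (ℕ; zero; suc; _≡ᵇ_; _<ᵇ_; _≤_; _<_)
open import Data.Product using (_×_; _,_; proj₁; proj₂)
open import Relation.Binary.PropositionalEquality using (_≡_)

module Comparison where

  open import Data.Bool.Properties using (T-≡; ¬-not)
  open import Data.Nat.Properties using (≡ᵇ⇒≡; ≡⇒≡ᵇ; <ᵇ⇒<; <⇒<ᵇ; ≤⇒≯)
  open import Function using (Equivalence)
  open import Relation.Binary.PropositionalEquality using (refl; sym; trans; _≢_)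

  <ᵇ-true : ∀ {m n} → m < n → (m <ᵇ n) ≡ true
  <ᵇ-true m<n = Equivalence.to T-≡ (<⇒<ᵇ m<n)

  <ᵇ-false : ∀ {m n} → n ≤ m → (m <ᵇ n) ≡ false
  <ᵇ-false {m} {n} n≤m = ¬-not (λ m<ᵇn → ≤⇒≯ n≤m (<ᵇ⇒< m n (Equivalence.from T-≡ m<ᵇn)))

  <ᵇ-sound : ∀ m n → (m <ᵇ n) ≡ true → m < n
  <ᵇ-sound m n eq = <ᵇ⇒< m n (Equivalence.from T-≡ eq)

  ≡ᵇ-sound : ∀ m n → (m ≡ᵇ n) ≡ true → m ≡ n
  ≡ᵇ-sound m n eq = ≡ᵇ⇒≡ m n (Equivalence.from T-≡ eq)

  ≡ᵇ-refl : ∀ m → (m ≡ᵇ m) ≡ true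
  ≡ᵇ-refl m = Equivalence.to T-≡ (≡⇒≡ᵇ m m refl)

  ≡ᵇ-false : ∀ {m n} → m ≢ n → (m ≡ᵇ n) ≡ false
  ≡ᵇ-false {m} {n} m≢n = ¬-not (λ eq → m≢n (≡ᵇ-sound m n eq))

  ≡ᵇ-false⇒≢ : ∀ m n → (m ≡ᵇ n) ≡ false → m ≢ n
  ≡ᵇ-false⇒≢ m .m eq refl with trans (sym (≡ᵇ-refl m)) eq
  ... | ()

  ≡ᵇ-sym : ∀ m n → (m ≡ᵇ n) ≡ (n ≡ᵇ m)
  ≡ᵇ-sym zero    zero    = refl
  ≡ᵇ-sym zero    (suc n) = refl
  ≡ᵇ-sym (suc m) zero    = refl
  ≡ᵇ-sym (suc m) (suc n) = ≡ᵇ-sym m n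

open Comparison

module RangeSum {c ℓ} (R : CommutativeSemiring c ℓ) where

  open CommutativeSemiring R
  open QArith R using (sumR)
  open import Algebra.Properties.CommutativeSemigroup +-commutativeSemigroup using (interchange)
  open import Data.List.Properties using (upTo-∷ʳ; map-++)
  open import Data.Nat.Properties
    using (m<n⇒m<1+n; n<1+n; ≤-pred; ≤-antisym; ≮⇒≥; >⇒≢; <⇒≢; m≤n⇒∃[o]m+o≡n; +-suc; m≤m+n)
    renaming (+-identityʳ to +ℕ-identityʳ)
  open import Data.Nat using (_<?_) renaming (_+_ to _+ℕ_)
  open import Relation.Binary.PropositionalEquality as ≡ using (cong)
  open import Relation.Nullary using (yes; no)
  open import Relation.Binary.Reasoning.Setoid setoid

  ∑< : (K : ℕ) → ((i : ℕ) → i < K → Carrier) → Carrier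
  ∑< zero    f = 0#
  ∑< (suc K) f = ∑< K (λ i i<K → f i (m<n⇒m<1+n i<K)) + f K (n<1+n K)

  ∑ : ℕ → (ℕ → Carrier) → Carrier
  ∑ K f = ∑< K (λ i _ → f i)

  ∑<-cong : ∀ K {f g : (i : ℕ) → i < K → Carrier} → (∀ i i<K → f i i<K ≈ g i i<K) → ∑< K f ≈ ∑< K g
  ∑<-cong zero    f≈g = refl
  ∑<-cong (suc K) f≈g = +-cong (∑<-cong K (λ i i<K → f≈g i (m<n⇒m<1+n i<K))) (f≈g K (n<1+n K))

  ∑-cong : ∀ K {f g : ℕ → Carrier} → (∀ i → i < K → f i ≈ g i) → ∑ K f ≈ ∑ K g
  ∑-cong K = ∑<-cong K

  ∑-zero : ∀ K {f : ℕ → Carrier} → (∀ i → i < K → f i ≈ 0#) → ∑ K f ≈ 0#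
  ∑-zero zero    f≈0 = refl
  ∑-zero (suc K) f≈0 =
    trans (+-cong (∑-zero K (λ i i<K → f≈0 i (m<n⇒m<1+n i<K))) (f≈0 K (n<1+n K))) (+-identityʳ 0#)

  ∑<-+ : ∀ K (f g : (i : ℕ) → i < K → Carrier) → ∑< K (λ i p → f i p + g i p) ≈ ∑< K f + ∑< K g
  ∑<-+ zero    f g = sym (+-identityʳ 0#)
  ∑<-+ (suc K) f g = trans (+-congʳ (∑<-+ K _ _)) (interchange _ _ _ _)

  ∑-+ : ∀ K (f g : ℕ → Carrier) → ∑ K (λ i → f i + g i) ≈ ∑ K f + ∑ K g
  ∑-+ K f g = ∑<-+ K (λ i _ → f i) (λ i _ → g i)

  ∑<-*ˡ : ∀ K a (f : (i : ℕ) → i < K → Carrier) → ∑< K (λ i p → a * f i p) ≈ a * ∑< K f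
  ∑<-*ˡ zero    a f = sym (zeroʳ a)
  ∑<-*ˡ (suc K) a f = trans (+-congʳ (∑<-*ˡ K a _)) (sym (distribˡ a _ _))

  ∑<-*ʳ : ∀ K a (f : (i : ℕ) → i < K → Carrier) → ∑< K (λ i p → f i p * a) ≈ ∑< K f * a
  ∑<-*ʳ K a f = trans (∑<-cong K (λ i p → *-comm (f i p) a)) (trans (∑<-*ˡ K a f) (*-comm a _))

  ∑-indicator : ∀ K j (f : ℕ → Carrier) → j < K → ∑ K (λ i → if i ≡ᵇ j then f i else 0#) ≈ f j
  ∑-indicator (suc K) j f j<1+K with j <? K
  ... | yes j<K = begin
    ∑ K (λ i → if i ≡ᵇ j then f i else 0#) + (if K ≡ᵇ j then f K else 0#)
      ≈⟨ +-cong (∑-indicator K j f j<K) (reflexive (cong (if_then f K else 0#) (≡ᵇ-false (>⇒≢ j<K)))) ⟩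
    f j + 0#
      ≈⟨ +-identityʳ (f j) ⟩
    f j ∎
  ... | no j≮K with ≤-antisym (≤-pred j<1+K) (≮⇒≥ j≮K)
  ... | ≡.refl = begin
    ∑ j (λ i → if i ≡ᵇ j then f i else 0#) + (if j ≡ᵇ j then f j else 0#)
      ≈⟨ +-cong (∑-zero j (λ i i<j → reflexive (cong (if_then f i else 0#) (≡ᵇ-false (<⇒≢ i<j)))))
                (reflexive (cong (if_then f j else 0#) (≡ᵇ-refl j))) ⟩
    0# + f j
      ≈⟨ +-identityˡ (f j) ⟩
    f j ∎

  ∑-prefix : ∀ K J (f : ℕ → Carrier) → J ≤ K → ∑ K (λ i → if i <ᵇ J then f i else 0#) ≈ ∑ J f
  ∑-prefix K J f J≤K with m≤n⇒∃[o]m+o≡n J≤K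
  ... | o , ≡.refl = go o
    where
    g : ℕ → Carrier
    g i = if i <ᵇ J then f i else 0#
    go : ∀ o → ∑ (J +ℕ o) g ≈ ∑ J f
    go zero    = trans (reflexive (cong (λ m → ∑ m g) (+ℕ-identityʳ J)))
                       (∑-cong J (λ i i<J → reflexive (cong (if_then f i else 0#) (<ᵇ-true i<J))))
    go (suc o) = begin
      ∑ (J +ℕ suc o) g           ≡⟨ cong (λ m → ∑ m g) (+-suc J o) ⟩
      ∑ (J +ℕ o) g + g (J +ℕ o)  ≈⟨ +-congˡ (reflexive (cong (if_then f (J +ℕ o) else 0#) (<ᵇ-false (m≤m+n J o)))) ⟩
      ∑ (J +ℕ o) g + 0#          ≈⟨ +-identityʳ _ ⟩
      ∑ (J +ℕ o) g               ≈⟨ go o ⟩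
      ∑ J f ∎

  sumR-++ : ∀ xs ys → sumR (xs ++ ys) ≈ sumR xs + sumR ys
  sumR-++ []       ys = sym (+-identityˡ _)
  sumR-++ (x ∷ xs) ys = trans (+-congˡ (sumR-++ xs ys)) (sym (+-assoc x _ _))

  sumR-map-upTo : ∀ (f : ℕ → Carrier) m → sumR (map f (upTo m)) ≈ ∑ m f
  sumR-map-upTo f zero    = refl
  sumR-map-upTo f (suc m) = begin
    sumR (map f (upTo (suc m)))      ≡⟨ cong (λ xs → sumR (map f xs)) (≡.sym (upTo-∷ʳ m)) ⟩
    sumR (map f (upTo m ∷ʳ m))       ≡⟨ cong sumR (map-++ f (upTo m) (m ∷ [])) ⟩
    sumR (map f (upTo m) ∷ʳ f m)     ≈⟨ sumR-++ (map f (upTo m)) (f m ∷ []) ⟩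
    sumR (map f (upTo m)) + (f m + 0#) ≈⟨ +-cong (sumR-map-upTo f m) (+-identityʳ (f m)) ⟩
    ∑ m f + f m ∎

  sumR-map-cong : ∀ {A : Set} {f g : A → Carrier} xs → (∀ x → f x ≈ g x) → sumR (map f xs) ≈ sumR (map g xs)
  sumR-map-cong []       f≈g = refl
  sumR-map-cong (x ∷ xs) f≈g = +-cong (f≈g x) (sumR-map-cong xs f≈g)

  sumR-concatMap : ∀ {A B : Set} (f : B → Carrier) (g : A → List B) xs →
                   sumR (map f (concatMap g xs)) ≈ sumR (map (λ x → sumR (map f (g x))) xs)
  sumR-concatMap f g []       = refl
  sumR-concatMap f g (x ∷ xs) = begin
    sumR (map f (g x ++ concatMap g xs))                  ≡⟨ cong sumR (map-++ f (g x) (concatMap g xs)) ⟩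
    sumR (map f (g x) ++ map f (concatMap g xs))          ≈⟨ sumR-++ (map f (g x)) _ ⟩
    sumR (map f (g x)) + sumR (map f (concatMap g xs))    ≈⟨ +-congˡ (sumR-concatMap f g xs) ⟩
    sumR (map f (g x)) + sumR (map (λ x → sumR (map f (g x))) xs) ∎

  sumR-filter : ∀ {A : Set} (p : A → Bool) (f : A → Carrier) xs →
                sumR (map f (filterᵇ' p xs)) ≈ sumR (map (λ x → if p x then f x else 0#) xs)
  sumR-filter p f []       = refl
  sumR-filter p f (x ∷ xs) with p x
  ... | true  = +-congˡ (sumR-filter p f xs)
  ... | false = trans (sumR-filter p f xs) (sym (+-identityˡ _))

module Counting where

  open import Data.Bool.Properties using (∧-zeroʳ; ∧-identityʳ)
  open import Data.Nat
  open import Data.Nat.Properties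
  open import Algebra.Properties.CommutativeSemigroup +-commutativeSemigroup using (xy∙z≈xz∙y)
  open import Relation.Binary.Definitions using (tri<; tri≈; tri>)
  open import Relation.Binary.PropositionalEquality
  open import Relation.Nullary using (yes; no)
  open RangeSum +-*-commutativeSemiring public using (∑; ∑-cong; ∑-zero; ∑-+; ∑-indicator; ∑-prefix; sumR-map-upTo)

  indicator : Bool → ℕ
  indicator b = if b then 1 else 0

  count : (ℕ → Bool) → ℕ → ℕ
  count p m = ∑ m (λ i → indicator (p i))

  count-cong : ∀ {p q : ℕ → Bool} m → (∀ i → i < m → p i ≡ q i) → count p m ≡ count q m
  count-cong m p≡q = ∑-cong m (λ i i<m → cong indicator (p≡q i i<m))

  ∑-monoˡ-≤ : ∀ (f : ℕ → ℕ) {i j} → i ≤ j → ∑ i f ≤ ∑ j f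
  ∑-monoˡ-≤ f {j = zero}  z≤n = ≤-refl
  ∑-monoˡ-≤ f {i} {suc j} i≤1+j with i ≤? j
  ... | yes i≤j = ≤-trans (∑-monoˡ-≤ f i≤j) (m≤m+n _ _)
  ... | no  i≰j with ≤-antisym i≤1+j (≰⇒> i≰j)
  ... | refl = ≤-refl

  term≤∑ : ∀ (f : ℕ → ℕ) {i m} → i < m → f i ≤ ∑ m f
  term≤∑ f {i} i<m = ≤-trans (m≤n+m (f i) (∑ i f)) (∑-monoˡ-≤ f i<m)

  count-all : ∀ (p : ℕ → Bool) m → (∀ i → i < m → p i ≡ true) → count p m ≡ m
  count-all p zero    all = refl
  count-all p (suc m) all
    rewrite count-all p m (λ i i<m → all i (m<n⇒m<1+n i<m)) | all m (n<1+n m) = +-comm m 1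

  +-indicator≡ᵇ0 : ∀ n b → ((n + indicator b) ≡ᵇ 0) ≡ ((n ≡ᵇ 0) ∧ not b)
  +-indicator≡ᵇ0 n true  rewrite +-comm n 1 = sym (∧-zeroʳ (n ≡ᵇ 0))
  +-indicator≡ᵇ0 n false rewrite +-identityʳ n = sym (∧-identityʳ (n ≡ᵇ 0))

  count-witness : ∀ (p : ℕ → Bool) {j m} → j < m → p j ≡ true → (count p m ≡ᵇ 0) ≡ false
  count-witness p {j} {suc m} j<1+m pj with j <? m
  ... | yes j<m = trans (+-indicator≡ᵇ0 (count p m) (p m)) (cong (_∧ not (p m)) (count-witness p j<m pj))
  ... | no  j≮m with ≤-antisym (≤-pred j<1+m) (≮⇒≥ j≮m)
  ... | refl = trans (+-indicator≡ᵇ0 (count p j) (p j))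
                     (trans (cong (λ b → (count p j ≡ᵇ 0) ∧ not b) pj) (∧-zeroʳ _))

  count-<ᵇ : ∀ a k → a ≤ k → count (_<ᵇ a) k ≡ a
  count-<ᵇ a zero    z≤n  = refl
  count-<ᵇ a (suc k) a≤1+k with a ≤? k
  ... | yes a≤k rewrite count-<ᵇ a k a≤k | <ᵇ-false {k} {a} a≤k = +-identityʳ a
  ... | no  a≰k with ≤-antisym a≤1+k (≰⇒> a≰k)
  ... | refl = count-all _ (suc k) (λ i i<1+k → <ᵇ-true i<1+k)

  count-<ᵇ-suc : ∀ a k → a ≤ suc k → count (λ b → suc b <ᵇ a) k ≡ a ∸ 1
  count-<ᵇ-suc zero    k _     = ∑-zero k (λ _ _ → refl)
  count-<ᵇ-suc (suc a) k a<2+k = count-<ᵇ a k (≤-pred a<2+k)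

  count->ᵇ-suc : ∀ a k → count (λ b → a <ᵇ suc b) k ≡ k ∸ a
  count->ᵇ-suc zero    k = count-all _ k (λ _ _ → refl)
  count->ᵇ-suc (suc a) zero = refl
  count->ᵇ-suc (suc a) (suc k) with a <? k
  ... | yes a<k rewrite count->ᵇ-suc (suc a) k | <ᵇ-true a<k = trans (+-comm _ 1) (sym (+-∸-assoc 1 a<k))
  ... | no  a≮k rewrite count->ᵇ-suc (suc a) k | <ᵇ-false {a} {k} (≮⇒≥ a≮k)
                      | m≤n⇒m∸n≡0 (≮⇒≥ a≮k) | m≤n⇒m∸n≡0 (m≤n⇒m≤1+n (≮⇒≥ a≮k)) = refl

  count-remove : ∀ (Q : ℕ → Bool) {i k} → i < k →
                 count (λ b → not (i ≡ᵇ b) ∧ Q b) k + indicator (Q i) ≡ count Q k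
  count-remove Q {i} {suc k} i<1+k with i <? k
  ... | yes i<k rewrite ≡ᵇ-false (<⇒≢ i<k) =
    trans (xy∙z≈xz∙y (count (λ b → not (i ≡ᵇ b) ∧ Q b) k) _ _) (cong (_+ indicator (Q k)) (count-remove Q i<k))
  ... | no  i≮k with ≤-antisym (≤-pred i<1+k) (≮⇒≥ i≮k)
  ... | refl rewrite ≡ᵇ-refl i | +-identityʳ (count (λ b → not (i ≡ᵇ b) ∧ Q b) i) =
    cong (_+ indicator (Q i)) (count-cong i (λ b b<i → cong (λ x → not x ∧ Q b) (≡ᵇ-false (>⇒≢ b<i))))

  indicator-split : ∀ c d e → indicator (c ∧ e) ≡ indicator ((c ∧ not d) ∧ e) + indicator ((c ∧ d) ∧ e)
  indicator-split false d     e = refl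
  indicator-split true  true  e = refl
  indicator-split true  false e = sym (+-identityʳ _)

  count-≡ᵇ : ∀ g (Q : ℕ → Bool) i → count (λ j → (j ≡ᵇ g) ∧ Q j) i ≡ indicator ((g <ᵇ i) ∧ Q g)
  count-≡ᵇ g Q zero = refl
  count-≡ᵇ g Q (suc i) rewrite count-≡ᵇ g Q i with <-cmp g i
  ... | tri< g<i _ _ rewrite <ᵇ-true g<i | <ᵇ-true (m<n⇒m<1+n g<i) | ≡ᵇ-false (>⇒≢ g<i) = +-identityʳ _
  ... | tri≈ _ refl _ rewrite <ᵇ-false {g} {g} ≤-refl | <ᵇ-true (n<1+n g) | ≡ᵇ-refl g = refl
  ... | tri> _ _ g>i rewrite <ᵇ-false {g} {i} (<⇒≤ g>i) | <ᵇ-false {g} {suc i} g>i | ≡ᵇ-false (<⇒≢ g>i) = refl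

  indicator-∧ : ∀ a b → indicator (a ∧ b) ≡ (if b then indicator a else 0)
  indicator-∧ a true  = cong indicator (∧-identityʳ a)
  indicator-∧ a false = cong indicator (∧-zeroʳ a)

  count-∧-<ᵇ : ∀ (Q : ℕ → Bool) {i k} → i ≤ k → count (λ j → Q j ∧ (j <ᵇ i)) k ≡ count Q i
  count-∧-<ᵇ Q {i} {k} i≤k = trans (∑-cong k (λ j _ → indicator-∧ (Q j) (j <ᵇ i))) (∑-prefix k i _ i≤k)

module Words where

  open import Data.Bool.Properties using (∧-zeroʳ; ∧-identityʳ; ∧-assoc; if-eta)
  open import Data.List using (foldl; drop)
  open import Data.Nat.ListAction using (sum)
  open import Data.List.Properties using (upTo-∷ʳ; foldl-++; length-upTo; drop-all)
  open import Data.Nat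
  open import Data.Nat.Properties
  open import Algebra.Properties.CommutativeSemigroup +-commutativeSemigroup using (xy∙z≈xz∙y; interchange)
  open import Data.Nat.Solver using (module +-*-Solver)
  open +-*-Solver using (solve; _:+_; _:=_)
  open import Relation.Binary.PropositionalEquality
  open import Relation.Nullary using (yes; no)
  open Counting

  countᵇ≡count : ∀ p m → countᵇ p (upTo m) ≡ count p m
  countᵇ≡count p m = trans (countᵇ-sum (upTo m)) (sumR-map-upTo _ m)
    where
    countᵇ-sum : ∀ xs → countᵇ p xs ≡ sum (map (λ i → indicator (p i)) xs)
    countᵇ-sum []       = refl
    countᵇ-sum (x ∷ xs) = cong (indicator (p x) +_) (countᵇ-sum xs)

  countᵇ-++ : ∀ p xs ys → countᵇ p (xs ++ ys) ≡ countᵇ p xs + countᵇ p ys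
  countᵇ-++ p []       ys = refl
  countᵇ-++ p (x ∷ xs) ys = trans (cong (indicator (p x) +_) (countᵇ-++ p xs ys)) (sym (+-assoc (indicator (p x)) _ _))

  drop-∷ʳ : ∀ {A : Set} {m} (xs : List A) x → m ≤ length xs → drop m (xs ∷ʳ x) ≡ drop m xs ∷ʳ x
  drop-∷ʳ {m = zero}  xs       x _         = refl
  drop-∷ʳ {m = suc m} (y ∷ xs) x (s≤s m≤n) = drop-∷ʳ xs x m≤n

  countᵇ-after : ∀ p n j → countᵇ p (after n j) ≡ count (λ i → (j <ᵇ i) ∧ p i) n
  countᵇ-after p zero    j = refl
  countᵇ-after p (suc n) j with j <? n
  ... | yes j<n = begin
    countᵇ p (drop (suc j) (upTo (suc n)))
      ≡⟨ cong (λ xs → countᵇ p (drop (suc j) xs)) (upTo-∷ʳ n) ⟨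
    countᵇ p (drop (suc j) (upTo n ∷ʳ n))
      ≡⟨ cong (countᵇ p) (drop-∷ʳ (upTo n) n (subst (suc j ≤_) (sym (length-upTo n)) j<n)) ⟩
    countᵇ p (after n j ∷ʳ n)
      ≡⟨ countᵇ-++ p (after n j) (n ∷ []) ⟩
    countᵇ p (after n j) + (indicator (p n) + 0)
      ≡⟨ cong₂ _+_ (countᵇ-after p n j) (+-identityʳ _) ⟩
    count (λ i → (j <ᵇ i) ∧ p i) n + indicator (p n)
      ≡⟨ cong (λ b → count (λ i → (j <ᵇ i) ∧ p i) n + indicator (b ∧ p n)) (<ᵇ-true j<n) ⟨
    count (λ i → (j <ᵇ i) ∧ p i) n + indicator ((j <ᵇ n) ∧ p n) ∎
    where open ≡-Reasoning
  ... | no j≮n = trans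
    (cong (countᵇ p) (drop-all (suc j) (upTo (suc n))
      (subst (_≤ suc j) (sym (length-upTo (suc n))) (s≤s (≮⇒≥ j≮n)))))
    (sym (∑-zero (suc n) (λ i i<1+n →
      cong (λ b → indicator (b ∧ p i)) (<ᵇ-false (≤-pred (≤-trans i<1+n (s≤s (≮⇒≥ j≮n))))))))

  opener : List ℕ → ℕ → Bool
  opener w j = count (λ i → at w i ≡ᵇ at w j) j ≡ᵇ 0

  closer : List ℕ → ℕ → Bool
  closer w j = count (λ i → (j <ᵇ i) ∧ (at w i ≡ᵇ at w j)) (length w) ≡ᵇ 0

  rosAt′ : List ℕ → ℕ → ℕ
  rosAt′ w i = count (λ j → opener w j ∧ (at w i <ᵇ at w j)) i

  lcsAt′ : List ℕ → ℕ → ℕ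
  lcsAt′ w i = count (λ j → closer w j ∧ (at w j <ᵇ at w i)) i

  ros′ lcs′ mak′ : List ℕ → ℕ
  ros′ w = ∑ (length w) (rosAt′ w)
  lcs′ w = ∑ (length w) (lcsAt′ w)
  mak′ w = ros′ w + lcs′ w

  nrinv′ : List ℕ → ℕ → ℕ
  nrinv′ w b = count (λ a → (b <ᵇ a) ∧ (at w b <ᵇ at w a)) (length w)

  lastPos : List ℕ → ℕ → ℕ → ℕ
  lastPos w b zero    = 0
  lastPos w b (suc m) = if at w m ≡ᵇ b then m else lastPos w b m

  lastIndexOf : List ℕ → ℕ → ℕ
  lastIndexOf w b = lastPos w b (length w)

  nrinvLast : List ℕ → ℕ → ℕ
  nrinvLast w b = nrinv′ w (lastIndexOf w b)

  mak≡mak′ : ∀ w → mak w ≡ mak′ w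
  mak≡mak′ w = cong₂ _+_
    (trans (sumR-map-upTo _ (length w)) (∑-cong (length w) (λ i _ →
      trans (countᵇ≡count _ i) (count-cong i (λ j _ →
        cong (λ b → b ∧ (at w i <ᵇ at w j)) (cong (_≡ᵇ 0) (countᵇ≡count _ j)))))))
    (trans (sumR-map-upTo _ (length w)) (∑-cong (length w) (λ i _ →
      trans (countᵇ≡count _ i) (count-cong i (λ j _ →
        cong (λ b → b ∧ (at w j <ᵇ at w i)) (cong (_≡ᵇ 0) (countᵇ-after _ (length w) j)))))))

  nrinv-largestIn≡nrinvLast : ∀ w b → nrinv w (largestIn w b) ≡ nrinvLast w b
  nrinv-largestIn≡nrinvLast w b = trans (countᵇ≡count _ (length w)) (cong (nrinv′ w) (foldl≡lastPos (length w)))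
    where
    step : ℕ → ℕ → ℕ
    step acc i = if at w i ≡ᵇ b then i else acc
    foldl≡lastPos : ∀ m → foldl step 0 (upTo m) ≡ lastPos w b m
    foldl≡lastPos zero    = refl
    foldl≡lastPos (suc m) = begin
      foldl step 0 (upTo (suc m))     ≡⟨ cong (foldl step 0) (sym (upTo-∷ʳ m)) ⟩
      foldl step 0 (upTo m ++ m ∷ []) ≡⟨ foldl-++ step 0 (upTo m) (m ∷ []) ⟩
      step (foldl step 0 (upTo m)) m  ≡⟨ cong (λ acc → step acc m) (foldl≡lastPos m) ⟩
      lastPos w b (suc m) ∎
      where open ≡-Reasoning

  at-∷ʳ-< : ∀ (w : List ℕ) a {i} → i < length w → at (w ∷ʳ a) i ≡ at w i
  at-∷ʳ-< (x ∷ w) a {zero}  _         = refl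
  at-∷ʳ-< (x ∷ w) a {suc i} (s≤s i<n) = at-∷ʳ-< w a i<n

  at-∷ʳ-length : ∀ (w : List ℕ) a → at (w ∷ʳ a) (length w) ≡ a
  at-∷ʳ-length []      a = refl
  at-∷ʳ-length (x ∷ w) a = at-∷ʳ-length w a

  length-∷ʳ : ∀ (w : List ℕ) a → length (w ∷ʳ a) ≡ suc (length w)
  length-∷ʳ []      a = refl
  length-∷ʳ (x ∷ w) a = cong suc (length-∷ʳ w a)

  at-∷ʳ-≤ : ∀ (w : List ℕ) {a K} → (∀ j → at w j ≤ K) → a ≤ K → ∀ i → at (w ∷ʳ a) i ≤ K
  at-∷ʳ-≤ []      w≤K a≤K zero    = a≤K
  at-∷ʳ-≤ []      w≤K a≤K (suc i) = z≤n
  at-∷ʳ-≤ (x ∷ w) w≤K a≤K zero    = w≤K 0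
  at-∷ʳ-≤ (x ∷ w) w≤K a≤K (suc i) = at-∷ʳ-≤ w (λ j → w≤K (suc j)) a≤K i

  -- Derivations of restricted growth words; every partition word has exactly one.
  data RGW : ℕ → List ℕ → Set where
    nil : RGW 0 []
    new : ∀ {k w} → RGW k w → RGW (suc k) (w ∷ʳ suc k)
    old : ∀ {k w} → RGW k w → (i : ℕ) → i < k → RGW k (w ∷ʳ suc i)

  RGW-at≤ : ∀ {k w} → RGW k w → ∀ i → at w i ≤ k
  RGW-at≤ nil                   i = z≤n
  RGW-at≤ (new {w = w} g)       i = at-∷ʳ-≤ w (λ j → m≤n⇒m≤1+n (RGW-at≤ g j)) ≤-refl i
  RGW-at≤ (old {w = w} g a a<k) i = at-∷ʳ-≤ w (RGW-at≤ g) a<k i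

  lastPos-∷ʳ : ∀ w a b {m} → m ≤ length w → lastPos (w ∷ʳ a) b m ≡ lastPos w b m
  lastPos-∷ʳ w a b {zero}  _     = refl
  lastPos-∷ʳ w a b {suc m} m<n
    rewrite at-∷ʳ-< w a m<n | lastPos-∷ʳ w a b (≤-trans (n≤1+n m) m<n) = refl

  lastIndexOf-∷ʳ : ∀ w a b → lastIndexOf (w ∷ʳ a) b ≡ (if a ≡ᵇ b then length w else lastIndexOf w b)
  lastIndexOf-∷ʳ w a b rewrite length-∷ʳ w a | at-∷ʳ-length w a | lastPos-∷ʳ w a b ≤-refl = refl

  Occurs : List ℕ → ℕ → Set
  Occurs w b = (at w (lastIndexOf w b) ≡ b) × (lastIndexOf w b < length w)

  Occurs-∷ʳ : ∀ w a b → ((a ≡ᵇ b) ≡ false → Occurs w b) → Occurs (w ∷ʳ a) b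
  Occurs-∷ʳ w a b occurs rewrite lastIndexOf-∷ʳ w a b | length-∷ʳ w a with a ≡ᵇ b in a≡ᵇb
  ... | true  = trans (at-∷ʳ-length w a) (≡ᵇ-sound a b a≡ᵇb) , ≤-refl
  ... | false = trans (at-∷ʳ-< w a (proj₂ (occurs refl))) (proj₁ (occurs refl)) , m≤n⇒m≤1+n (proj₂ (occurs refl))

  RGW-Occurs : ∀ {k w} → RGW k w → ∀ {b} → 1 ≤ b → b ≤ k → Occurs w b
  RGW-Occurs nil {zero}  () _
  RGW-Occurs nil {suc b} _  ()
  RGW-Occurs (new {k} {w} g) {b} 1≤b b≤1+k = Occurs-∷ʳ w (suc k) b λ 1+k≢b →
    RGW-Occurs g 1≤b (≤-pred (≤∧≢⇒< b≤1+k (λ b≡1+k → ≡ᵇ-false⇒≢ (suc k) b 1+k≢b (sym b≡1+k))))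
  RGW-Occurs (old {k} {w} g a a<k) {b} 1≤b b≤k = Occurs-∷ʳ w (suc a) b (λ _ → RGW-Occurs g 1≤b b≤k)

  nrinvLast-∷ʳ-self : ∀ w a → nrinvLast (w ∷ʳ a) a ≡ 0
  nrinvLast-∷ʳ-self w a rewrite lastIndexOf-∷ʳ w a a | ≡ᵇ-refl a | length-∷ʳ w a =
    ∑-zero (suc (length w)) (λ i i<1+n →
      cong (λ b → indicator (b ∧ (at (w ∷ʳ a) (length w) <ᵇ at (w ∷ʳ a) i))) (<ᵇ-false (≤-pred i<1+n)))

  nrinvLast-∷ʳ-other : ∀ {k w} → RGW k w → ∀ a {b} → 1 ≤ b → b ≤ k → (a ≡ᵇ b) ≡ false →
                       nrinvLast (w ∷ʳ a) b ≡ nrinvLast w b + indicator (b <ᵇ a)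
  nrinvLast-∷ʳ-other {k} {w} g a {b} 1≤b b≤k a≢b rewrite lastIndexOf-∷ʳ w a b | a≢b | length-∷ʳ w a =
    cong₂ _+_
      (count-cong (length w) (λ i i<n → cong₂ (λ x y → (L <ᵇ i) ∧ (x <ᵇ y)) (at-∷ʳ-< w a L<n) (at-∷ʳ-< w a i<n)))
      (cong indicator (cong₂ _∧_ (<ᵇ-true L<n) (cong₂ _<ᵇ_ (trans (at-∷ʳ-< w a L<n) wL≡b) (at-∷ʳ-length w a))))
    where
    L = lastIndexOf w b
    wL≡b : at w L ≡ b
    wL≡b = proj₁ (RGW-Occurs g 1≤b b≤k)
    L<n : L < length w
    L<n = proj₂ (RGW-Occurs g 1≤b b≤k)

  opener-∷ʳ : ∀ w a {j} → j < length w → opener (w ∷ʳ a) j ≡ opener w j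
  opener-∷ʳ w a j<n = cong (_≡ᵇ 0) (count-cong _ (λ i i<j →
    cong₂ _≡ᵇ_ (at-∷ʳ-< w a (<-trans i<j j<n)) (at-∷ʳ-< w a j<n)))

  opener-∷ʳ-length : ∀ w a → opener (w ∷ʳ a) (length w) ≡ (count (λ i → at w i ≡ᵇ a) (length w) ≡ᵇ 0)
  opener-∷ʳ-length w a = cong (_≡ᵇ 0) (count-cong (length w) (λ i i<n →
    cong₂ _≡ᵇ_ (at-∷ʳ-< w a i<n) (at-∷ʳ-length w a)))

  closer-∷ʳ : ∀ w a {j} → j < length w → closer (w ∷ʳ a) j ≡ (closer w j ∧ not (a ≡ᵇ at w j))
  closer-∷ʳ w a {j} j<n rewrite length-∷ʳ w a = trans
    (cong (_≡ᵇ 0) (cong₂ _+_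
      (count-cong (length w) (λ i i<n → cong ((j <ᵇ i) ∧_) (cong₂ _≡ᵇ_ (at-∷ʳ-< w a i<n) (at-∷ʳ-< w a j<n))))
      (cong indicator (cong₂ _∧_ (<ᵇ-true j<n) (cong₂ _≡ᵇ_ (at-∷ʳ-length w a) (at-∷ʳ-< w a j<n))))))
    (+-indicator≡ᵇ0 (count (λ i → (j <ᵇ i) ∧ (at w i ≡ᵇ at w j)) (length w)) (a ≡ᵇ at w j))

  closer-∷ʳ-length : ∀ w a → closer (w ∷ʳ a) (length w) ≡ true
  closer-∷ʳ-length w a rewrite length-∷ʳ w a = cong (_≡ᵇ 0) (∑-zero (suc (length w)) (λ i i<1+n →
    cong (λ b → indicator (b ∧ (at (w ∷ʳ a) i ≡ᵇ at (w ∷ʳ a) (length w)))) (<ᵇ-false (≤-pred i<1+n))))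

  -- Each block has exactly one opener.
  count-openers : ∀ {k w} → RGW k w → ∀ (P : ℕ → Bool) →
                  count (λ j → opener w j ∧ P (at w j)) (length w) ≡ count (λ b → P (suc b)) k
  count-openers nil P = refl
  count-openers (new {k} {w} g) P rewrite length-∷ʳ w (suc k) = cong₂ _+_
    (trans (count-cong (length w) (λ j j<n → cong₂ _∧_ (opener-∷ʳ w (suc k) j<n) (cong P (at-∷ʳ-< w _ j<n))))
           (count-openers g P))
    (cong indicator (cong₂ _∧_
      (trans (opener-∷ʳ-length w (suc k)) (cong (_≡ᵇ 0) (∑-zero (length w) (λ i _ →
        cong indicator (≡ᵇ-false (λ wi≡1+k → 1+n≰n (subst (_≤ k) wi≡1+k (RGW-at≤ g i))))))))
      (cong P (at-∷ʳ-length w (suc k)))))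
  count-openers (old {k} {w} g a a<k) P rewrite length-∷ʳ w (suc a) = trans (cong₂ _+_
    (trans (count-cong (length w) (λ j j<n → cong₂ _∧_ (opener-∷ʳ w (suc a) j<n) (cong P (at-∷ʳ-< w _ j<n))))
           (count-openers g P))
    (cong (λ b → indicator (b ∧ P (at (w ∷ʳ suc a) (length w))))
      (trans (opener-∷ʳ-length w (suc a))
             (count-witness _ (proj₂ occurs) (trans (cong (_≡ᵇ suc a) (proj₁ occurs)) (≡ᵇ-refl (suc a)))))))
    (+-identityʳ _)
    where
    occurs : Occurs w (suc a)
    occurs = RGW-Occurs g (s≤s z≤n) a<k

  -- Each block has exactly one closer.
  count-closers : ∀ {k w} → RGW k w → ∀ (P : ℕ → Bool) →
                  count (λ j → closer w j ∧ P (at w j)) (length w) ≡ count (λ b → P (suc b)) k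
  count-closers-∷ʳ : ∀ {k w} → RGW k w → ∀ a (P : ℕ → Bool) →
    count (λ j → closer (w ∷ʳ a) j ∧ P (at (w ∷ʳ a) j)) (length (w ∷ʳ a))
      ≡ count (λ b → not (a ≡ᵇ suc b) ∧ P (suc b)) k + indicator (P a)
  count-closers-∷ʳ {k} {w} g a P =
    trans (cong (count (λ j → closer (w ∷ʳ a) j ∧ P (at (w ∷ʳ a) j))) (length-∷ʳ w a))
    (cong₂ _+_
      (trans (count-cong (length w) (λ j j<n →
                trans (cong₂ _∧_ (closer-∷ʳ w a j<n) (cong P (at-∷ʳ-< w _ j<n))) (∧-assoc (closer w j) _ _)))
             (count-closers g (λ b → not (a ≡ᵇ b) ∧ P b)))
      (cong indicator (cong₂ _∧_ (closer-∷ʳ-length w a) (cong P (at-∷ʳ-length w a)))))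
  count-closers nil P = refl
  count-closers (new {k} {w} g) P = trans (count-closers-∷ʳ g (suc k) P)
    (cong (_+ indicator (P (suc k)))
          (count-cong k (λ b b<k → cong (λ x → not x ∧ P (suc b)) (≡ᵇ-false (>⇒≢ b<k)))))
  count-closers (old {k} {w} g a a<k) P = trans (count-closers-∷ʳ g (suc a) P) (count-remove (λ b → P (suc b)) a<k)

  ∧-≢ᵇ-∧-≡ᵇ : ∀ c x y b → ((c ∧ not (x ≡ᵇ y)) ∧ (y ≡ᵇ b)) ≡ (if x ≡ᵇ b then false else (c ∧ (y ≡ᵇ b)))
  ∧-≢ᵇ-∧-≡ᵇ c x y b with y ≡ᵇ b in y≡ᵇb
  ... | false = trans (∧-zeroʳ _) (sym (trans (cong (if x ≡ᵇ b then false else_) (∧-zeroʳ c)) (if-eta _)))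
  ... | true rewrite ≡ᵇ-sound y b y≡ᵇb with x ≡ᵇ b
  ...   | true  = trans (∧-identityʳ _) (∧-zeroʳ c)
  ...   | false = ∧-identityʳ _

  closer-in-block : ∀ {k w} → RGW k w → ∀ {b} → 1 ≤ b → b ≤ k → ∀ {j} → j < length w →
                    (closer w j ∧ (at w j ≡ᵇ b)) ≡ (j ≡ᵇ lastIndexOf w b)
  closer-in-block-∷ʳ : ∀ {k w} → RGW k w → ∀ a {b} → 1 ≤ b → ((a ≡ᵇ b) ≡ false → b ≤ k) →
                       ∀ {j} → j < length (w ∷ʳ a) →
                       (closer (w ∷ʳ a) j ∧ (at (w ∷ʳ a) j ≡ᵇ b)) ≡ (j ≡ᵇ lastIndexOf (w ∷ʳ a) b)
  closer-in-block-∷ʳ {k} {w} g a {b} 1≤b b≤k {j} j<1+n rewrite lastIndexOf-∷ʳ w a b with j <? length w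
  ... | yes j<n rewrite closer-∷ʳ w a j<n | at-∷ʳ-< w a j<n | ∧-≢ᵇ-∧-≡ᵇ (closer w j) a (at w j) b
    with a ≡ᵇ b in a≡ᵇb
  ...   | true  = sym (≡ᵇ-false (<⇒≢ j<n))
  ...   | false = closer-in-block g 1≤b (b≤k refl) j<n
  closer-in-block-∷ʳ {k} {w} g a {b} 1≤b b≤k {j} j<1+n | no j≮n
    with ≤-antisym (≤-pred (subst (j <_) (length-∷ʳ w a) j<1+n)) (≮⇒≥ j≮n)
  ... | refl rewrite closer-∷ʳ-length w a | at-∷ʳ-length w a with a ≡ᵇ b
  ...   | true  = sym (≡ᵇ-refl j)
  ...   | false = sym (≡ᵇ-false (>⇒≢ (proj₂ (RGW-Occurs g 1≤b (b≤k refl)))))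
  closer-in-block nil _ _ ()
  closer-in-block (new {k} {w} g) {b} 1≤b b≤1+k = closer-in-block-∷ʳ g (suc k) 1≤b (λ 1+k≢b →
    ≤-pred (≤∧≢⇒< b≤1+k (λ b≡1+k → ≡ᵇ-false⇒≢ (suc k) b 1+k≢b (sym b≡1+k))))
  closer-in-block (old {k} {w} g a a<k) 1≤b b≤k = closer-in-block-∷ʳ g (suc a) 1≤b (λ _ → b≤k)

  ros′-∷ʳ : ∀ {k w} → RGW k w → ∀ a → ros′ (w ∷ʳ a) ≡ ros′ w + (k ∸ a)
  ros′-∷ʳ {k} {w} g a = trans (cong (λ m → ∑ m (rosAt′ (w ∷ʳ a))) (length-∷ʳ w a)) (cong₂ _+_
    (∑-cong (length w) (λ i i<n → count-cong i (λ j j<i →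
      cong₂ _∧_ (opener-∷ʳ w a (<-trans j<i i<n)) (cong₂ _<ᵇ_ (at-∷ʳ-< w a i<n) (at-∷ʳ-< w a (<-trans j<i i<n))))))
    (trans (count-cong (length w) (λ j j<n →
              cong₂ _∧_ (opener-∷ʳ w a j<n) (cong₂ _<ᵇ_ (at-∷ʳ-length w a) (at-∷ʳ-< w a j<n))))
           (trans (count-openers g (a <ᵇ_)) (count->ᵇ-suc a k))))

  ∧-≢ᵇ-∧-<ᵇ : ∀ c a y → ((c ∧ not (a ≡ᵇ y)) ∧ (y <ᵇ a)) ≡ (c ∧ (y <ᵇ a))
  ∧-≢ᵇ-∧-<ᵇ c a y with y <ᵇ a in y<ᵇa
  ... | false = trans (∧-zeroʳ _) (sym (∧-zeroʳ c))
  ... | true rewrite ≡ᵇ-false (>⇒≢ (<ᵇ-sound y a y<ᵇa)) = cong (_∧ true) (∧-identityʳ c)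

  lcsAt′-∷ʳ : ∀ w a {i} → i < length w →
              lcsAt′ (w ∷ʳ a) i ≡ count (λ j → (closer w j ∧ not (a ≡ᵇ at w j)) ∧ (at w j <ᵇ at w i)) i
  lcsAt′-∷ʳ w a i<n = count-cong _ (λ j j<i →
    cong₂ _∧_ (closer-∷ʳ w a (<-trans j<i i<n)) (cong₂ _<ᵇ_ (at-∷ʳ-< w a (<-trans j<i i<n)) (at-∷ʳ-< w a i<n)))

  lcsAt′-∷ʳ-length : ∀ {k w} → RGW k w → ∀ a → a ≤ suc k → lcsAt′ (w ∷ʳ a) (length w) ≡ a ∸ 1
  lcsAt′-∷ʳ-length {k} {w} g a a≤1+k = trans
    (count-cong (length w) (λ j j<n → trans
      (cong₂ _∧_ (closer-∷ʳ w a j<n) (cong₂ _<ᵇ_ (at-∷ʳ-< w a j<n) (at-∷ʳ-length w a)))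
      (∧-≢ᵇ-∧-<ᵇ (closer w j) a (at w j))))
    (trans (count-closers g (_<ᵇ a)) (count-<ᵇ-suc a k a≤1+k))

  lcs′-∷ʳ-new : ∀ {k w} → RGW k w → lcs′ (w ∷ʳ suc k) ≡ lcs′ w + k
  lcs′-∷ʳ-new {k} {w} g = trans (cong (λ m → ∑ m (lcsAt′ (w ∷ʳ suc k))) (length-∷ʳ w (suc k))) (cong₂ _+_
    (∑-cong (length w) (λ i i<n → trans (lcsAt′-∷ʳ w (suc k) i<n) (count-cong i (λ j _ →
      cong (λ b → b ∧ (at w j <ᵇ at w i))
        (trans (cong (λ x → closer w j ∧ not x) (≡ᵇ-false (λ 1+k≡wj → 1+n≰n (subst (_≤ k) (sym 1+k≡wj) (RGW-at≤ g j)))))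
               (∧-identityʳ (closer w j)))))))
    (lcsAt′-∷ʳ-length g (suc k) ≤-refl))

  -- Appending a demotes the old closer of block a, losing the pairs counted by nrinvLast w a.
  lcsAt′-∷ʳ-old : ∀ {k w} → RGW k w → ∀ {a} → 1 ≤ a → a ≤ k → ∀ {i} → i < length w →
    lcsAt′ w i ≡ lcsAt′ (w ∷ʳ a) i + indicator ((lastIndexOf w a <ᵇ i) ∧ (at w (lastIndexOf w a) <ᵇ at w i))
  lcsAt′-∷ʳ-old {k} {w} g {a} 1≤a a≤k {i} i<n = begin
    lcsAt′ w i
      ≡⟨ ∑-cong i (λ j _ → indicator-split (closer w j) (a ≡ᵇ at w j) (at w j <ᵇ at w i)) ⟩
    ∑ i (λ j → indicator ((closer w j ∧ not (a ≡ᵇ at w j)) ∧ (at w j <ᵇ at w i))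
             + indicator ((closer w j ∧ (a ≡ᵇ at w j)) ∧ (at w j <ᵇ at w i)))
      ≡⟨ ∑-+ i _ _ ⟩
    count (λ j → (closer w j ∧ not (a ≡ᵇ at w j)) ∧ (at w j <ᵇ at w i)) i
      + count (λ j → (closer w j ∧ (a ≡ᵇ at w j)) ∧ (at w j <ᵇ at w i)) i
      ≡⟨ cong₂ _+_ (sym (lcsAt′-∷ʳ w a i<n)) (count-cong i (λ j j<i → cong (_∧ (at w j <ᵇ at w i))
           (trans (cong (closer w j ∧_) (≡ᵇ-sym a (at w j))) (closer-in-block g 1≤a a≤k (<-trans j<i i<n))))) ⟩
    lcsAt′ (w ∷ʳ a) i + count (λ j → (j ≡ᵇ lastIndexOf w a) ∧ (at w j <ᵇ at w i)) i
      ≡⟨ cong (lcsAt′ (w ∷ʳ a) i +_) (count-≡ᵇ (lastIndexOf w a) (λ j → at w j <ᵇ at w i) i) ⟩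
    lcsAt′ (w ∷ʳ a) i + indicator ((lastIndexOf w a <ᵇ i) ∧ (at w (lastIndexOf w a) <ᵇ at w i)) ∎
    where open ≡-Reasoning

  lcs′-∷ʳ-old : ∀ {k w} → RGW k w → ∀ {a} → 1 ≤ a → a ≤ k →
                lcs′ (w ∷ʳ a) + nrinvLast w a ≡ lcs′ w + (a ∸ 1)
  lcs′-∷ʳ-old {k} {w} g {a} 1≤a a≤k = begin
    lcs′ (w ∷ʳ a) + nrinvLast w a
      ≡⟨ cong (λ m → ∑ m (lcsAt′ (w ∷ʳ a)) + nrinvLast w a) (length-∷ʳ w a) ⟩
    ∑ n (lcsAt′ (w ∷ʳ a)) + lcsAt′ (w ∷ʳ a) n + nrinvLast w a
      ≡⟨ cong (λ m → ∑ n (lcsAt′ (w ∷ʳ a)) + m + nrinvLast w a) (lcsAt′-∷ʳ-length g a (m≤n⇒m≤1+n a≤k)) ⟩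
    ∑ n (lcsAt′ (w ∷ʳ a)) + (a ∸ 1) + nrinvLast w a
      ≡⟨ xy∙z≈xz∙y (∑ n (lcsAt′ (w ∷ʳ a))) (a ∸ 1) (nrinvLast w a) ⟩
    ∑ n (lcsAt′ (w ∷ʳ a)) + nrinvLast w a + (a ∸ 1)
      ≡⟨ cong (_+ (a ∸ 1)) (sym (∑-+ n (lcsAt′ (w ∷ʳ a)) _)) ⟩
    ∑ n (λ i → lcsAt′ (w ∷ʳ a) i + indicator ((L <ᵇ i) ∧ (at w L <ᵇ at w i))) + (a ∸ 1)
      ≡⟨ cong (_+ (a ∸ 1)) (sym (∑-cong n (λ i i<n → lcsAt′-∷ʳ-old g 1≤a a≤k i<n))) ⟩
    lcs′ w + (a ∸ 1) ∎
    where
    open ≡-Reasoning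
    n = length w
    L = lastIndexOf w a

  mak′-∷ʳ-new : ∀ {k w} → RGW k w → mak′ (w ∷ʳ suc k) ≡ mak′ w + k
  mak′-∷ʳ-new {k} {w} g
    rewrite ros′-∷ʳ g (suc k) | lcs′-∷ʳ-new g | m≤n⇒m∸n≡0 (n≤1+n k) | +-identityʳ (ros′ w) =
    sym (+-assoc (ros′ w) (lcs′ w) k)

  mak′-∷ʳ-old : ∀ {k w} → RGW k w → ∀ {a} → 1 ≤ a → a ≤ k →
                mak′ (w ∷ʳ a) + nrinvLast w a ≡ mak′ w + (k ∸ 1)
  mak′-∷ʳ-old {k} {w} g {a} 1≤a a≤k = begin
    ros′ (w ∷ʳ a) + lcs′ (w ∷ʳ a) + nrinvLast w a    ≡⟨ +-assoc (ros′ (w ∷ʳ a)) _ _ ⟩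
    ros′ (w ∷ʳ a) + (lcs′ (w ∷ʳ a) + nrinvLast w a)  ≡⟨ cong₂ _+_ (ros′-∷ʳ g a) (lcs′-∷ʳ-old g 1≤a a≤k) ⟩
    ros′ w + (k ∸ a) + (lcs′ w + (a ∸ 1))            ≡⟨ interchange (ros′ w) (k ∸ a) (lcs′ w) (a ∸ 1) ⟩
    ros′ w + lcs′ w + ((k ∸ a) + (a ∸ 1))            ≡⟨ cong (mak′ w +_) (∸-+-∸ 1≤a a≤k) ⟩
    mak′ w + (k ∸ 1) ∎
    where
    open ≡-Reasoning
    ∸-+-∸ : ∀ {a k} → 1 ≤ a → a ≤ k → (k ∸ a) + (a ∸ 1) ≡ k ∸ 1
    ∸-+-∸ {suc a} {suc k} _ (s≤s a≤k) = m∸n+n≡m a≤k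

  nrinvLast-∷ʳ-new : ∀ {k w} → RGW k w → ∀ {j} → j < k →
                     nrinvLast (w ∷ʳ suc k) (suc j) ≡ nrinvLast w (suc j) + 1
  nrinvLast-∷ʳ-new {w = w} g {j} j<k = trans (nrinvLast-∷ʳ-other g _ (s≤s z≤n) j<k (≡ᵇ-false (>⇒≢ j<k)))
                                             (cong (λ b → nrinvLast w (suc j) + indicator b) (<ᵇ-true j<k))

  countIn countOut : (ℕ → Bool) → ℕ → ℕ
  countIn  T i = count (λ b → T (suc b)) i
  countOut T i = count (λ b → not (T (suc b))) i

  countIn+countOut : ∀ T i → countIn T i + countOut T i ≡ i
  countIn+countOut T i = begin
    countIn T i + countOut T i
      ≡⟨ ∑-+ i _ _ ⟨
    ∑ i (λ b → indicator (T (suc b)) + indicator (not (T (suc b))))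
      ≡⟨ ∑-cong i (λ b _ → indicator+indicator-not (T (suc b))) ⟩
    count (λ _ → true) i
      ≡⟨ count-all _ i (λ _ _ → refl) ⟩
    i ∎
    where
    open ≡-Reasoning
    indicator+indicator-not : ∀ b → indicator b + indicator (not b) ≡ 1
    indicator+indicator-not true  = refl
    indicator+indicator-not false = refl

  countIn≤ : ∀ T i → countIn T i ≤ i
  countIn≤ T i = subst (countIn T i ≤_) (countIn+countOut T i) (m≤m+n (countIn T i) (countOut T i))

  countIn-strict : ∀ T {i K} → i < K → T (suc i) ≡ true → suc (countIn T i) ≤ countIn T K
  countIn-strict T {i} i<K Ti = ≤-trans
    (≤-reflexive (trans (+-comm 1 (countIn T i)) (cong (λ b → countIn T i + indicator b) (sym Ti))))
    (∑-monoˡ-≤ (λ b → indicator (T (suc b))) i<K)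

  insert : (ℕ → Bool) → ℕ → ℕ → Bool
  insert T a b = T b ∨ (b ≡ᵇ a)

  ∑In : (ℕ → Bool) → ℕ → (ℕ → ℕ) → ℕ
  ∑In T k f = ∑ k (λ j → if T (suc j) then f j else 0)

  ∑In-insert : ∀ T {i k} (f : ℕ → ℕ) → T (suc i) ≡ false → i < k →
               ∑In (insert T (suc i)) k f ≡ ∑In T k f + f i
  ∑In-insert T {i} {k} f Ti i<k = begin
    ∑In (insert T (suc i)) k f
      ≡⟨ ∑-cong k (λ j _ → split j) ⟩
    ∑ k (λ j → (if T (suc j) then f j else 0) + (if j ≡ᵇ i then f j else 0))
      ≡⟨ ∑-+ k _ _ ⟩
    ∑In T k f + ∑ k (λ j → if j ≡ᵇ i then f j else 0)
      ≡⟨ cong (∑In T k f +_) (∑-indicator k i f i<k) ⟩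
    ∑In T k f + f i ∎
    where
    open ≡-Reasoning
    split : ∀ j → (if insert T (suc i) (suc j) then f j else 0)
                  ≡ (if T (suc j) then f j else 0) + (if j ≡ᵇ i then f j else 0)
    split j with T (suc j) in Tj | j ≡ᵇ i in j≡ᵇi
    ... | true  | true  rewrite ≡ᵇ-sound j i j≡ᵇi with () ← trans (sym Tj) Ti
    ... | true  | false = sym (+-identityʳ _)
    ... | false | _     = refl

  nrinvIn : (ℕ → Bool) → ℕ → List ℕ → ℕ
  nrinvIn T k w = ∑In T k (λ j → nrinvLast w (suc j))

  offsetIn : (ℕ → Bool) → ℕ → ℕ
  offsetIn T k = ∑In T k (λ j → k ∸ suc j)

  if-+-indicator : ∀ b m n → (if b then m + n else 0) ≡ (if b then m else 0) + (if b then n else 0)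
  if-+-indicator true  m n = refl
  if-+-indicator false m n = refl

  ∑In-suc : ∀ T k (f g : ℕ → ℕ) → f k ≡ 0 → (∀ j → j < k → f j ≡ g j + 1) →
            ∑In T (suc k) f ≡ ∑In T k g + countIn T k
  ∑In-suc T k f g fk≡0 f≡g+1 = begin
    ∑In T k f + (if T (suc k) then f k else 0)
      ≡⟨ cong (∑In T k f +_) (trans (cong (if T (suc k) then_else 0) fk≡0) (if-eta (T (suc k)))) ⟩
    ∑In T k f + 0
      ≡⟨ +-identityʳ _ ⟩
    ∑In T k f
      ≡⟨ ∑-cong k (λ j j<k → trans (cong (if T (suc j) then_else 0) (f≡g+1 j j<k)) (if-+-indicator (T (suc j)) _ 1)) ⟩
    ∑ k (λ j → (if T (suc j) then g j else 0) + indicator (T (suc j)))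
      ≡⟨ ∑-+ k _ _ ⟩
    ∑In T k g + countIn T k ∎
    where open ≡-Reasoning

  nrinvIn-∷ʳ-new : ∀ {k w} → RGW k w → ∀ T → nrinvIn T (suc k) (w ∷ʳ suc k) ≡ nrinvIn T k w + countIn T k
  nrinvIn-∷ʳ-new {k} {w} g T = ∑In-suc T k _ _ (nrinvLast-∷ʳ-self w (suc k)) (λ j j<k → nrinvLast-∷ʳ-new g j<k)

  offsetIn-suc : ∀ T k → offsetIn T (suc k) ≡ offsetIn T k + countIn T k
  offsetIn-suc T k = ∑In-suc T k _ _ (n∸n≡0 k) (λ j j<k → trans (+-∸-assoc 1 j<k) (+-comm 1 (k ∸ suc j)))

  nrinvIn-∷ʳ-old : ∀ {k w} → RGW k w → ∀ T {i} → i < k →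
    nrinvIn T k (w ∷ʳ suc i) + (if T (suc i) then nrinvLast w (suc i) else 0) ≡ nrinvIn T k w + countIn T i
  nrinvIn-∷ʳ-old {k} {w} g T {i} i<k = begin
    nrinvIn T k (w ∷ʳ suc i) + X
      ≡⟨ cong (nrinvIn T k (w ∷ʳ suc i) +_) (∑-indicator k i (λ _ → X) i<k) ⟨
    nrinvIn T k (w ∷ʳ suc i) + ∑ k (λ j → if j ≡ᵇ i then X else 0)
      ≡⟨ ∑-+ k _ _ ⟨
    ∑ k (λ j → (if T (suc j) then nrinvLast (w ∷ʳ suc i) (suc j) else 0) + (if j ≡ᵇ i then X else 0))
      ≡⟨ ∑-cong k pointwise ⟩
    ∑ k (λ j → (if T (suc j) then nrinvLast w (suc j) else 0) + indicator (T (suc j) ∧ (j <ᵇ i)))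
      ≡⟨ ∑-+ k _ _ ⟩
    nrinvIn T k w + count (λ j → T (suc j) ∧ (j <ᵇ i)) k
      ≡⟨ cong (nrinvIn T k w +_) (count-∧-<ᵇ (λ j → T (suc j)) (<⇒≤ i<k)) ⟩
    nrinvIn T k w + countIn T i ∎
    where
    open ≡-Reasoning
    X = if T (suc i) then nrinvLast w (suc i) else 0
    pointwise : ∀ j → j < k →
      (if T (suc j) then nrinvLast (w ∷ʳ suc i) (suc j) else 0) + (if j ≡ᵇ i then X else 0)
        ≡ (if T (suc j) then nrinvLast w (suc j) else 0) + indicator (T (suc j) ∧ (j <ᵇ i))
    pointwise j j<k with j ≡ᵇ i in j≡ᵇi
    ... | true rewrite ≡ᵇ-sound j i j≡ᵇi | nrinvLast-∷ʳ-self w (suc i) | <ᵇ-false {i} {i} ≤-refl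
                     | ∧-zeroʳ (T (suc i)) | if-eta (T (suc i)) {0} = sym (+-identityʳ _)
    ... | false rewrite nrinvLast-∷ʳ-other g (suc i) (s≤s z≤n) j<k (trans (≡ᵇ-sym i j) j≡ᵇi) with T (suc j)
    ...   | true  = +-identityʳ _
    ...   | false = refl

  everyBlock : ℕ → Bool
  everyBlock _ = true

  countIn-everyBlock : ∀ i → countIn everyBlock i ≡ i
  countIn-everyBlock i = count-all _ i (λ _ _ → refl)

  lcs′≡nrinvIn-everyBlock : ∀ {k w} → RGW k w → lcs′ w ≡ nrinvIn everyBlock k w
  lcs′≡nrinvIn-everyBlock nil = refl
  lcs′≡nrinvIn-everyBlock (new {k} {w} g) = begin
    lcs′ (w ∷ʳ suc k)                       ≡⟨ lcs′-∷ʳ-new g ⟩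
    lcs′ w + k                              ≡⟨ cong₂ _+_ (lcs′≡nrinvIn-everyBlock g) (sym (countIn-everyBlock k)) ⟩
    nrinvIn everyBlock k w + countIn everyBlock k ≡⟨ nrinvIn-∷ʳ-new g everyBlock ⟨
    nrinvIn everyBlock (suc k) (w ∷ʳ suc k) ∎
    where open ≡-Reasoning
  lcs′≡nrinvIn-everyBlock (old {k} {w} g i i<k) = +-cancelʳ-≡ (nrinvLast w (suc i)) _ _ (begin
    lcs′ (w ∷ʳ suc i) + nrinvLast w (suc i) ≡⟨ lcs′-∷ʳ-old g (s≤s z≤n) i<k ⟩
    lcs′ w + i                              ≡⟨ cong₂ _+_ (lcs′≡nrinvIn-everyBlock g) (sym (countIn-everyBlock i)) ⟩
    nrinvIn everyBlock k w + countIn everyBlock i ≡⟨ nrinvIn-∷ʳ-old g everyBlock i<k ⟨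
    nrinvIn everyBlock k (w ∷ʳ suc i) + nrinvLast w (suc i) ∎)
    where open ≡-Reasoning

  -- As i runs over 0, …, k−1, the blocks i+1 ∈ T receive k−1, k−2, … and the others 0, 1, …:
  -- a permutation of 0, …, k−1 (∑-pow-oldIncrement).
  oldIncrement : (ℕ → Bool) → ℕ → ℕ → ℕ
  oldIncrement T k i = if T (suc i) then k ∸ suc (countIn T i) else countOut T i

  oldSet : (ℕ → Bool) → ℕ → (ℕ → Bool)
  oldSet T i = if T (suc i) then T else insert T (suc i)

  -- mak w + Σ_{b ∈ T} (k − b) − Σ_{b ∈ T} nrinv(g(B_b), w) (makSet-spec), computed along the
  -- derivation without subtraction; for T = {l} this is mak_l (makₗ≡makSet).
  makSet : ∀ {k w} → RGW k w → (ℕ → Bool) → ℕ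
  makSet nil             T = 0
  makSet (new {k} g)     T = makSet g T + k
  makSet (old {k} g i _) T = makSet g (oldSet T i) + oldIncrement T k i

  ∸-suc-+ : ∀ {t k} → t < k → (k ∸ suc t) + t ≡ k ∸ 1
  ∸-suc-+ {t} {suc k} (s≤s t≤k) = m∸n+n≡m t≤k

  makSet-spec-new : ∀ {k w} (g : RGW k w) T → makSet g T + nrinvIn T k w ≡ mak′ w + offsetIn T k →
                    makSet g T + k + nrinvIn T (suc k) (w ∷ʳ suc k) ≡ mak′ (w ∷ʳ suc k) + offsetIn T (suc k)
  makSet-spec-new {k} {w} g T ih = begin
    makSet g T + k + nrinvIn T (suc k) (w ∷ʳ suc k)  ≡⟨ cong (makSet g T + k +_) (nrinvIn-∷ʳ-new g T) ⟩
    makSet g T + k + (nrinvIn T k w + countIn T k)   ≡⟨ interchange (makSet g T) k _ _ ⟩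
    makSet g T + nrinvIn T k w + (k + countIn T k)   ≡⟨ cong (_+ (k + countIn T k)) ih ⟩
    mak′ w + offsetIn T k + (k + countIn T k)        ≡⟨ interchange (mak′ w) (offsetIn T k) k _ ⟩
    mak′ w + k + (offsetIn T k + countIn T k)        ≡⟨ cong₂ _+_ (mak′-∷ʳ-new g) (offsetIn-suc T k) ⟨
    mak′ (w ∷ʳ suc k) + offsetIn T (suc k) ∎
    where open ≡-Reasoning

  makSet-spec-in : ∀ {k w} (g : RGW k w) T {i} → i < k → T (suc i) ≡ true →
    makSet g T + nrinvIn T k w ≡ mak′ w + offsetIn T k →
    makSet g T + (k ∸ suc (countIn T i)) + nrinvIn T k (w ∷ʳ suc i) ≡ mak′ (w ∷ʳ suc i) + offsetIn T k
  makSet-spec-in {k} {w} g T {i} i<k Ti ih = +-cancelʳ-≡ v _ _ (begin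
    makSet g T + d + nrinvIn T k w′ + v      ≡⟨ +-assoc (makSet g T + d) _ _ ⟩
    makSet g T + d + (nrinvIn T k w′ + v)    ≡⟨ cong (makSet g T + d +_) nrinvIn-w′ ⟩
    makSet g T + d + (nrinvIn T k w + t)     ≡⟨ interchange (makSet g T) d _ t ⟩
    makSet g T + nrinvIn T k w + (d + t)     ≡⟨ cong₂ _+_ ih (∸-suc-+ (≤-<-trans (countIn≤ T i) i<k)) ⟩
    mak′ w + offsetIn T k + (k ∸ 1)          ≡⟨ xy∙z≈xz∙y (mak′ w) _ _ ⟩
    mak′ w + (k ∸ 1) + offsetIn T k          ≡⟨ cong (_+ offsetIn T k) (mak′-∷ʳ-old g (s≤s z≤n) i<k) ⟨
    mak′ w′ + v + offsetIn T k               ≡⟨ xy∙z≈xz∙y (mak′ w′) _ _ ⟩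
    mak′ w′ + offsetIn T k + v ∎)
    where
    open ≡-Reasoning
    w′ = w ∷ʳ suc i
    v = nrinvLast w (suc i)
    t = countIn T i
    d = k ∸ suc t
    nrinvIn-w′ : nrinvIn T k w′ + v ≡ nrinvIn T k w + t
    nrinvIn-w′ = trans (cong (λ b → nrinvIn T k w′ + (if b then v else 0)) (sym Ti)) (nrinvIn-∷ʳ-old g T i<k)

  makSet-spec-out : ∀ {k w} (g : RGW k w) T {i} → i < k → T (suc i) ≡ false →
    makSet g (insert T (suc i)) + nrinvIn (insert T (suc i)) k w ≡ mak′ w + offsetIn (insert T (suc i)) k →
    makSet g (insert T (suc i)) + countOut T i + nrinvIn T k (w ∷ʳ suc i) ≡ mak′ (w ∷ʳ suc i) + offsetIn T k
  makSet-spec-out {k} {w} g T {i} i<k Ti ih = +-cancelʳ-≡ v _ _ (begin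
    makSet g T′ + u + nrinvIn T k w′ + v
      ≡⟨ cong (λ n → makSet g T′ + u + n + v) nrinvIn-w′ ⟩
    makSet g T′ + u + (nrinvIn T k w + t) + v
      ≡⟨ solve 5 (λ e u n t v → e :+ u :+ (n :+ t) :+ v := e :+ (n :+ v) :+ (t :+ u)) refl (makSet g T′) u _ t v ⟩
    makSet g T′ + (nrinvIn T k w + v) + (t + u)
      ≡⟨ cong₂ (λ m n → makSet g T′ + m + n) (∑In-insert T (λ j → nrinvLast w (suc j)) Ti i<k)
                                            (sym (countIn+countOut T i)) ⟨
    makSet g T′ + nrinvIn T′ k w + i
      ≡⟨ cong (_+ i) ih ⟩
    mak′ w + offsetIn T′ k + i
      ≡⟨ cong (λ n → mak′ w + n + i) (∑In-insert T (λ j → k ∸ suc j) Ti i<k) ⟩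
    mak′ w + (offsetIn T k + (k ∸ suc i)) + i
      ≡⟨ solve 4 (λ m c d i → m :+ (c :+ d) :+ i := m :+ (d :+ i) :+ c) refl (mak′ w) (offsetIn T k) _ i ⟩
    mak′ w + ((k ∸ suc i) + i) + offsetIn T k
      ≡⟨ cong (λ n → mak′ w + n + offsetIn T k) (∸-suc-+ i<k) ⟩
    mak′ w + (k ∸ 1) + offsetIn T k
      ≡⟨ cong (_+ offsetIn T k) (mak′-∷ʳ-old g (s≤s z≤n) i<k) ⟨
    mak′ w′ + v + offsetIn T k
      ≡⟨ xy∙z≈xz∙y (mak′ w′) _ _ ⟩
    mak′ w′ + offsetIn T k + v ∎)
    where
    open ≡-Reasoning
    T′ = insert T (suc i)
    w′ = w ∷ʳ suc i
    v = nrinvLast w (suc i)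
    t = countIn T i
    u = countOut T i
    nrinvIn-w′ : nrinvIn T k w′ ≡ nrinvIn T k w + t
    nrinvIn-w′ = trans (sym (+-identityʳ _))
      (trans (cong (λ b → nrinvIn T k w′ + (if b then v else 0)) (sym Ti)) (nrinvIn-∷ʳ-old g T i<k))

  makSet-spec : ∀ {k w} (g : RGW k w) T → makSet g T + nrinvIn T k w ≡ mak′ w + offsetIn T k
  makSet-spec nil             T = refl
  makSet-spec (new g)         T = makSet-spec-new g T (makSet-spec g T)
  makSet-spec (old g i i<k)   T with T (suc i) in Ti
  ... | true  = makSet-spec-in g T i<k Ti (makSet-spec g T)
  ... | false = makSet-spec-out g T i<k Ti (makSet-spec g (insert T (suc i)))

  makₗ≡makSet : ∀ {k w} (g : RGW k w) {l} → 1 ≤ l → l ≤ k → makₗ k l w ≡ makSet g (_≡ᵇ l)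
  makₗ≡makSet {k} {w} g {suc l} _ l<k = +-cancelʳ-≡ v _ _ (begin
    (mak w ∸ nrinv w (largestIn w (suc l))) + (k ∸ suc l) + v
      ≡⟨ cong₂ (λ m n → (m ∸ n) + (k ∸ suc l) + v) (mak≡mak′ w) (nrinv-largestIn≡nrinvLast w (suc l)) ⟩
    (mak′ w ∸ v) + (k ∸ suc l) + v        ≡⟨ xy∙z≈xz∙y (mak′ w ∸ v) _ _ ⟩
    (mak′ w ∸ v) + v + (k ∸ suc l)        ≡⟨ cong (_+ (k ∸ suc l)) (m∸n+n≡m v≤mak′) ⟩
    mak′ w + (k ∸ suc l)                  ≡⟨ cong (mak′ w +_) (∑-indicator k l (λ j → k ∸ suc j) l<k) ⟨
    mak′ w + offsetIn (_≡ᵇ suc l) k       ≡⟨ makSet-spec g (_≡ᵇ suc l) ⟨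
    makSet g (_≡ᵇ suc l) + nrinvIn (_≡ᵇ suc l) k w
      ≡⟨ cong (makSet g (_≡ᵇ suc l) +_) (∑-indicator k l (λ j → nrinvLast w (suc j)) l<k) ⟩
    makSet g (_≡ᵇ suc l) + v ∎)
    where
    open ≡-Reasoning
    v = nrinvLast w (suc l)
    v≤mak′ : v ≤ mak′ w
    v≤mak′ = ≤-trans (term≤∑ (λ j → nrinvLast w (suc j)) l<k)
                     (≤-trans (≤-reflexive (sym (lcs′≡nrinvIn-everyBlock g))) (m≤n+m (lcs′ w) (ros′ w)))

module RGWSum {c ℓ} (R : CommutativeSemiring c ℓ) where

  open CommutativeSemiring R
  open RangeSum R
  open Words using (RGW; nil; new; old)
  open import Algebra.Properties.CommutativeSemigroup +-commutativeSemigroup using (interchange)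

  ∑RGW : (n k : ℕ) → (∀ {w} → RGW k w → Carrier) → Carrier
  ∑RGW zero    zero    f = f nil
  ∑RGW zero    (suc k) f = 0#
  ∑RGW (suc n) zero    f = 0#
  ∑RGW (suc n) (suc k) f =
    ∑RGW n k (λ g → f (new g)) + ∑RGW n (suc k) (λ g → ∑< (suc k) (λ i i<k → f (old g i i<k)))

  ∑RGW-cong : ∀ n k {f h : ∀ {w} → RGW k w → Carrier} → (∀ {w} (g : RGW k w) → f g ≈ h g) →
              ∑RGW n k f ≈ ∑RGW n k h
  ∑RGW-cong zero    zero    f≈h = f≈h nil
  ∑RGW-cong zero    (suc k) f≈h = refl
  ∑RGW-cong (suc n) zero    f≈h = refl
  ∑RGW-cong (suc n) (suc k) f≈h =
    +-cong (∑RGW-cong n k (λ g → f≈h (new g)))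
           (∑RGW-cong n (suc k) (λ g → ∑<-cong (suc k) (λ i p → f≈h (old g i p))))

  ∑RGW-0 : ∀ n k → ∑RGW n k (λ _ → 0#) ≈ 0#
  ∑RGW-0 zero    zero    = refl
  ∑RGW-0 zero    (suc k) = refl
  ∑RGW-0 (suc n) zero    = refl
  ∑RGW-0 (suc n) (suc k) = trans
    (+-cong (∑RGW-0 n k) (trans (∑RGW-cong n (suc k) (λ _ → ∑-zero (suc k) (λ _ _ → refl))) (∑RGW-0 n (suc k))))
    (+-identityʳ 0#)

  ∑RGW-+ : ∀ n k (f h : ∀ {w} → RGW k w → Carrier) → ∑RGW n k (λ g → f g + h g) ≈ ∑RGW n k f + ∑RGW n k h
  ∑RGW-+ zero    zero    f h = refl
  ∑RGW-+ zero    (suc k) f h = sym (+-identityʳ 0#)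
  ∑RGW-+ (suc n) zero    f h = sym (+-identityʳ 0#)
  ∑RGW-+ (suc n) (suc k) f h = trans
    (+-cong (∑RGW-+ n k _ _)
            (trans (∑RGW-cong n (suc k) (λ g → ∑<-+ (suc k) (λ i p → f (old g i p)) (λ i p → h (old g i p))))
                   (∑RGW-+ n (suc k) _ _)))
    (interchange _ _ _ _)

  ∑RGW-*ˡ : ∀ n k a (f : ∀ {w} → RGW k w → Carrier) → ∑RGW n k (λ g → a * f g) ≈ a * ∑RGW n k f
  ∑RGW-*ˡ zero    zero    a f = refl
  ∑RGW-*ˡ zero    (suc k) a f = sym (zeroʳ a)
  ∑RGW-*ˡ (suc n) zero    a f = sym (zeroʳ a)
  ∑RGW-*ˡ (suc n) (suc k) a f = trans
    (+-cong (∑RGW-*ˡ n k a _)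
            (trans (∑RGW-cong n (suc k) (λ g → ∑<-*ˡ (suc k) a (λ i p → f (old g i p)))) (∑RGW-*ˡ n (suc k) a _)))
    (sym (distribˡ a _ _))

  ∑RGW-∑< : ∀ K n k (F : (i : ℕ) → i < K → ∀ {w} → RGW k w → Carrier) →
            ∑RGW n k (λ g → ∑< K (λ i p → F i p g)) ≈ ∑< K (λ i p → ∑RGW n k (F i p))
  ∑RGW-∑< zero    n k F = ∑RGW-0 n k
  ∑RGW-∑< (suc K) n k F = trans (∑RGW-+ n k _ _) (+-congʳ (∑RGW-∑< K n k _))

module GeneratingFunction {c ℓ} (R : CommutativeSemiring c ℓ) (q : CommutativeSemiring.Carrier R) where

  open CommutativeSemiring R
  open QArith R using (pow; qInt; Sq)
  open RangeSum R
  open RGWSum R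
  open Words using (makSet; oldIncrement; oldSet; countIn; countOut; countIn+countOut; countIn-strict)
  open import Data.Nat using (_∸_) renaming (_+_ to _+ℕ_)
  import Data.Nat.Properties as ℕ
  open import Relation.Binary.PropositionalEquality as ≡ using (cong)
  open import Relation.Binary.Reasoning.Setoid setoid

  pow-+ : ∀ m n → pow q (m +ℕ n) ≈ pow q m * pow q n
  pow-+ zero    n = sym (*-identityˡ _)
  pow-+ (suc m) n = trans (*-congˡ (pow-+ m n)) (sym (*-assoc q _ _))

  ∑pow-+ : ∀ u t → ∑ (u +ℕ t) (pow q) ≈ ∑ u (pow q) + pow q u * ∑ t (pow q)
  ∑pow-+ u zero = begin
    ∑ (u +ℕ 0) (pow q)                ≡⟨ cong (λ m → ∑ m (pow q)) (ℕ.+-identityʳ u) ⟩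
    ∑ u (pow q)                       ≈⟨ +-identityʳ _ ⟨
    ∑ u (pow q) + 0#                  ≈⟨ +-congˡ (zeroʳ _) ⟨
    ∑ u (pow q) + pow q u * 0# ∎
  ∑pow-+ u (suc t) = begin
    ∑ (u +ℕ suc t) (pow q)                                   ≡⟨ cong (λ m → ∑ m (pow q)) (ℕ.+-suc u t) ⟩
    ∑ (u +ℕ t) (pow q) + pow q (u +ℕ t)                      ≈⟨ +-cong (∑pow-+ u t) (pow-+ u t) ⟩
    ∑ u (pow q) + pow q u * ∑ t (pow q) + pow q u * pow q t  ≈⟨ +-assoc _ _ _ ⟩
    ∑ u (pow q) + (pow q u * ∑ t (pow q) + pow q u * pow q t) ≈⟨ +-congˡ (distribˡ _ _ _) ⟨
    ∑ u (pow q) + pow q u * ∑ (suc t) (pow q) ∎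

  q*∑pow+1 : ∀ t → q * ∑ t (pow q) + 1# ≈ ∑ (suc t) (pow q)
  q*∑pow+1 t = begin
    q * ∑ t (pow q) + 1#                 ≈⟨ +-comm _ _ ⟩
    1# + q * ∑ t (pow q)                 ≈⟨ +-cong (+-identityˡ 1#) (*-congʳ (*-identityʳ q)) ⟨
    ∑ 1 (pow q) + pow q 1 * ∑ t (pow q)  ≈⟨ ∑pow-+ 1 t ⟨
    ∑ (suc t) (pow q) ∎

  ∑-pow-countOut : ∀ T K → ∑ K (λ i → if T (suc i) then 0# else pow q (countOut T i)) ≈ ∑ (countOut T K) (pow q)
  ∑-pow-countOut T zero    = refl
  ∑-pow-countOut T (suc K) with T (suc K)
  ... | true  = trans (+-identityʳ _)
                      (trans (∑-pow-countOut T K) (reflexive (cong (λ m → ∑ m (pow q)) (≡.sym (ℕ.+-identityʳ u)))))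
    where u = countOut T K
  ... | false = trans (+-congʳ (∑-pow-countOut T K))
                      (reflexive (cong (λ m → ∑ m (pow q)) (≡.sym (ℕ.+-comm u 1))))
    where u = countOut T K

  ∑-pow-countIn : ∀ T K → ∑ K (λ i → if T (suc i) then pow q (countIn T K ∸ suc (countIn T i)) else 0#)
                          ≈ ∑ (countIn T K) (pow q)
  ∑-pow-countIn T zero    = refl
  ∑-pow-countIn T (suc K) with T (suc K)
  ... | true = begin
    ∑ K (λ i → if T (suc i) then pow q (t +ℕ 1 ∸ suc (countIn T i)) else 0#) + pow q (t +ℕ 1 ∸ suc t)
      ≈⟨ +-cong (∑-cong K shift) (reflexive (cong (pow q) t+1∸[1+t]≡0)) ⟩
    ∑ K (λ i → q * (if T (suc i) then pow q (t ∸ suc (countIn T i)) else 0#)) + 1#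
      ≈⟨ +-congʳ (trans (∑<-*ˡ K q _) (*-congˡ (∑-pow-countIn T K))) ⟩
    q * ∑ t (pow q) + 1#
      ≈⟨ q*∑pow+1 t ⟩
    ∑ (suc t) (pow q)
      ≡⟨ cong (λ m → ∑ m (pow q)) (ℕ.+-comm 1 t) ⟩
    ∑ (t +ℕ 1) (pow q) ∎
    where
    t = countIn T K
    t+1∸[1+t]≡0 : t +ℕ 1 ∸ suc t ≡ 0
    t+1∸[1+t]≡0 = ≡.trans (cong (_∸ suc t) (ℕ.+-comm t 1)) (ℕ.n∸n≡0 t)
    shift : ∀ i → i < K → (if T (suc i) then pow q (t +ℕ 1 ∸ suc (countIn T i)) else 0#)
                          ≈ q * (if T (suc i) then pow q (t ∸ suc (countIn T i)) else 0#)
    shift i i<K with T (suc i) in Ti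
    ... | true  = reflexive (cong (pow q) (≡.trans (cong (_∸ suc (countIn T i)) (ℕ.+-comm t 1))
                                                    (ℕ.+-∸-assoc 1 (countIn-strict T i<K Ti))))
    ... | false = sym (zeroʳ q)
  ... | false = trans (+-identityʳ _)
    (trans (∑-cong K (λ i _ → reflexive (cong (exponent i) (ℕ.+-identityʳ t))))
           (trans (∑-pow-countIn T K) (reflexive (cong (λ m → ∑ m (pow q)) (≡.sym (ℕ.+-identityʳ t))))))
    where
    t = countIn T K
    exponent : ℕ → ℕ → Carrier
    exponent i m = if T (suc i) then pow q (m ∸ suc (countIn T i)) else 0#

  ∑-pow-oldIncrement : ∀ T K → ∑ K (λ i → pow q (oldIncrement T K i)) ≈ ∑ K (pow q)
  ∑-pow-oldIncrement T K = begin
    ∑ K (λ i → pow q (oldIncrement T K i))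
      ≈⟨ ∑-cong K split ⟩
    ∑ K (λ i → pow q u * (if T (suc i) then pow q (countIn T K ∸ suc (countIn T i)) else 0#)
               + (if T (suc i) then 0# else pow q (countOut T i)))
      ≈⟨ ∑-+ K _ _ ⟩
    ∑ K (λ i → pow q u * (if T (suc i) then pow q (countIn T K ∸ suc (countIn T i)) else 0#))
      + ∑ K (λ i → if T (suc i) then 0# else pow q (countOut T i))
      ≈⟨ +-cong (trans (∑<-*ˡ K _ _) (*-congˡ (∑-pow-countIn T K))) (∑-pow-countOut T K) ⟩
    pow q u * ∑ (countIn T K) (pow q) + ∑ u (pow q)
      ≈⟨ +-comm _ _ ⟩
    ∑ u (pow q) + pow q u * ∑ (countIn T K) (pow q)
      ≈⟨ ∑pow-+ u (countIn T K) ⟨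
    ∑ (u +ℕ countIn T K) (pow q)
      ≡⟨ cong (λ m → ∑ m (pow q)) (≡.trans (ℕ.+-comm u (countIn T K)) (countIn+countOut T K)) ⟩
    ∑ K (pow q) ∎
    where
    u = countOut T K
    split : ∀ i → i < K → pow q (oldIncrement T K i)
                          ≈ pow q u * (if T (suc i) then pow q (countIn T K ∸ suc (countIn T i)) else 0#)
                            + (if T (suc i) then 0# else pow q (countOut T i))
    split i i<K with T (suc i) in Ti
    ... | true = begin
      pow q (K ∸ suc (countIn T i))
        ≡⟨ cong (λ m → pow q (m ∸ suc (countIn T i)))
                (≡.trans (≡.sym (countIn+countOut T K)) (ℕ.+-comm (countIn T K) u)) ⟩
      pow q (u +ℕ countIn T K ∸ suc (countIn T i))
        ≡⟨ cong (pow q) (ℕ.+-∸-assoc u (countIn-strict T i<K Ti)) ⟩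
      pow q (u +ℕ (countIn T K ∸ suc (countIn T i)))
        ≈⟨ pow-+ u _ ⟩
      pow q u * pow q (countIn T K ∸ suc (countIn T i))
        ≈⟨ +-identityʳ _ ⟨
      pow q u * pow q (countIn T K ∸ suc (countIn T i)) + 0# ∎
    ... | false = trans (sym (+-identityˡ _)) (+-congʳ (sym (zeroʳ _)))

  ∑RGW-makSet : ∀ n k T → ∑RGW n k (λ g → pow q (makSet g T)) ≈ Sq q n k
  ∑RGW-makSet-+ : ∀ n k T d → ∑RGW n k (λ g → pow q (makSet g T +ℕ d)) ≈ pow q d * Sq q n k
  ∑RGW-makSet-+ n k T d = begin
    ∑RGW n k (λ g → pow q (makSet g T +ℕ d))
      ≈⟨ ∑RGW-cong n k (λ g → trans (pow-+ (makSet g T) d) (*-comm _ _)) ⟩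
    ∑RGW n k (λ g → pow q d * pow q (makSet g T))
      ≈⟨ ∑RGW-*ˡ n k (pow q d) _ ⟩
    pow q d * ∑RGW n k (λ g → pow q (makSet g T))
      ≈⟨ *-congˡ (∑RGW-makSet n k T) ⟩
    pow q d * Sq q n k ∎

  ∑RGW-makSet zero    zero    T = refl
  ∑RGW-makSet zero    (suc k) T = refl
  ∑RGW-makSet (suc n) zero    T = refl
  ∑RGW-makSet (suc n) (suc k) T = +-cong (∑RGW-makSet-+ n k T k) (begin
    ∑RGW n (suc k) (λ g → ∑< (suc k) (λ i i<k → pow q (makSet g (oldSet T i) +ℕ oldIncrement T (suc k) i)))
      ≈⟨ ∑RGW-∑< (suc k) n (suc k) _ ⟩
    ∑< (suc k) (λ i i<k → ∑RGW n (suc k) (λ g → pow q (makSet g (oldSet T i) +ℕ oldIncrement T (suc k) i)))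
      ≈⟨ ∑<-cong (suc k) (λ i _ → ∑RGW-makSet-+ n (suc k) (oldSet T i) (oldIncrement T (suc k) i)) ⟩
    ∑ (suc k) (λ i → pow q (oldIncrement T (suc k) i) * Sq q n (suc k))
      ≈⟨ ∑<-*ʳ (suc k) _ _ ⟩
    ∑ (suc k) (λ i → pow q (oldIncrement T (suc k) i)) * Sq q n (suc k)
      ≈⟨ *-congʳ (trans (∑-pow-oldIncrement T (suc k)) (sym (sumR-map-upTo (pow q) (suc k)))) ⟩
    qInt q (suc k) * Sq q n (suc k) ∎)

module PartitionWords where

  open import Data.Bool.Properties using (∧-assoc; ∧-zeroʳ)
  open import Data.Nat
  open import Data.Nat.Properties
  open import Relation.Binary.Definitions using (tri<; tri≈; tri>)
  open import Relation.Binary.PropositionalEquality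
  open import Relation.Nullary using (yes; no)

  maxL-++ : ∀ (w ys : List ℕ) → maxL (w ++ ys) ≡ maxL w ⊔ maxL ys
  maxL-++ []      ys = refl
  maxL-++ (x ∷ w) ys = trans (cong (x ⊔_) (maxL-++ w ys)) (sym (⊔-assoc x (maxL w) (maxL ys)))

  isRGFfrom-++ : ∀ m (w ys : List ℕ) → isRGFfrom m (w ++ ys) ≡ (isRGFfrom m w ∧ isRGFfrom (m ⊔ maxL w) ys)
  isRGFfrom-++ m []      ys = cong (λ m′ → isRGFfrom m′ ys) (sym (⊔-identityʳ m))
  isRGFfrom-++ m (x ∷ w) ys = begin
    a ∧ (b ∧ isRGFfrom (m ⊔ x) (w ++ ys))
      ≡⟨ cong (λ c → a ∧ (b ∧ c)) (isRGFfrom-++ (m ⊔ x) w ys) ⟩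
    a ∧ (b ∧ (isRGFfrom (m ⊔ x) w ∧ isRGFfrom (m ⊔ x ⊔ maxL w) ys))
      ≡⟨ trans (cong (a ∧_) (sym (∧-assoc b _ _))) (sym (∧-assoc a _ _)) ⟩
    (a ∧ (b ∧ isRGFfrom (m ⊔ x) w)) ∧ isRGFfrom (m ⊔ x ⊔ maxL w) ys
      ≡⟨ cong (λ m′ → (a ∧ (b ∧ isRGFfrom (m ⊔ x) w)) ∧ isRGFfrom m′ ys) (⊔-assoc m x (maxL w)) ⟩
    (a ∧ (b ∧ isRGFfrom (m ⊔ x) w)) ∧ isRGFfrom (m ⊔ (x ⊔ maxL w)) ys ∎
    where
    open ≡-Reasoning
    a = 0 <ᵇ x
    b = x <ᵇ suc (suc m)

  growsTo : ℕ → ℕ → ℕ → Bool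
  growsTo m i J = (i <ᵇ suc m) ∧ ((m ⊔ suc i) ≡ᵇ J)

  isPartitionWord-∷ʳ : ∀ J w i → isPartitionWord J (w ∷ʳ suc i) ≡ (isRGFfrom 0 w ∧ growsTo (maxL w) i J)
  isPartitionWord-∷ʳ J w i rewrite isRGFfrom-++ 0 w (suc i ∷ []) | maxL-++ w (suc i ∷ [])
    with isRGFfrom 0 w | i <ᵇ suc (maxL w)
  ... | false | _     = refl
  ... | true  | false = refl
  ... | true  | true  = refl

  growsTo-zero : ∀ m i → growsTo m i 0 ≡ false
  growsTo-zero zero    i = ∧-zeroʳ _
  growsTo-zero (suc m) i = ∧-zeroʳ _

  growsTo-< : ∀ {m j} i → m < j → growsTo m i (suc j) ≡ false
  growsTo-< {m} {j} i m<j with i ≤? m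
  ... | yes i≤m = trans (cong ((i <ᵇ suc m) ∧_) (≡ᵇ-false (λ m⊔1+i≡1+j →
                    1+n≰n (subst (_≤ j) m⊔1+i≡1+j (⊔-lub (≤-trans (n≤1+n m) m<j) (≤-trans (s≤s i≤m) m<j))))))
                        (∧-zeroʳ _)
  ... | no  i≰m = cong (_∧ ((m ⊔ suc i) ≡ᵇ suc j)) (<ᵇ-false (≰⇒> i≰m))

  growsTo-> : ∀ {m j} i → suc j < m → growsTo m i (suc j) ≡ false
  growsTo-> {m} i 1+j<m =
    trans (cong ((i <ᵇ suc m) ∧_) (≡ᵇ-false (>⇒≢ (<-≤-trans 1+j<m (m≤m⊔n m (suc i)))))) (∧-zeroʳ _)

  growsTo-max : ∀ j i → growsTo j i (suc j) ≡ (i ≡ᵇ j)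
  growsTo-max j i with <-cmp i j
  ... | tri< i<j _ _ rewrite <ᵇ-true (m<n⇒m<1+n i<j) | m≥n⇒m⊔n≡m i<j | ≡ᵇ-false (<⇒≢ (n<1+n j))
                           | ≡ᵇ-false (<⇒≢ i<j) = refl
  ... | tri≈ _ refl _ rewrite <ᵇ-true (n<1+n i) | m≤n⇒m⊔n≡n (n≤1+n i) | ≡ᵇ-refl i = refl
  ... | tri> _ _ i>j rewrite <ᵇ-false {i} {suc j} i>j | ≡ᵇ-false (>⇒≢ i>j) = refl

  growsTo-suc : ∀ j i → growsTo (suc j) i (suc j) ≡ (i <ᵇ suc j)
  growsTo-suc j i with <-cmp i (suc j)
  ... | tri< i<1+j _ _ rewrite <ᵇ-true (m<n⇒m<1+n i<1+j) | m≥n⇒m⊔n≡m (≤-pred i<1+j) | ≡ᵇ-refl j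
                             | <ᵇ-true i<1+j = refl
  ... | tri≈ _ refl _ rewrite <ᵇ-true (n<1+n (suc j)) | m≤n⇒m⊔n≡n (n≤1+n j) | ≡ᵇ-false (>⇒≢ (n<1+n j))
                            | <ᵇ-false {j} {j} ≤-refl = refl
  ... | tri> _ _ i>1+j rewrite <ᵇ-false {i} {suc (suc j)} i>1+j | <ᵇ-false {i} {suc j} (<⇒≤ i>1+j) = refl

module Enumeration {c ℓ} (R : CommutativeSemiring c ℓ) where

  open CommutativeSemiring R
  open QArith R using (sumR)
  open RangeSum R
  open RGWSum R
  open PartitionWords
  open import Data.Bool.Properties using (∧-zeroʳ)
  open import Data.Empty using (⊥-elim)
  open import Data.List.Properties using (map-∘)
  import Data.Nat.Properties as ℕ
  open import Relation.Binary.Definitions using (tri<; tri≈; tri>)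
  open import Relation.Binary.PropositionalEquality as ≡ using (cong)
  open import Relation.Binary.Reasoning.Setoid setoid

  ∑Words : ℕ → ℕ → (List ℕ → Carrier) → Carrier
  ∑Words zero    k h = h []
  ∑Words (suc n) k h = ∑Words n k (λ w → ∑ k (λ i → h (w ∷ʳ suc i)))

  ∑Words-cong : ∀ n k {h h′ : List ℕ → Carrier} → (∀ w → h w ≈ h′ w) → ∑Words n k h ≈ ∑Words n k h′
  ∑Words-cong zero    k h≈h′ = h≈h′ []
  ∑Words-cong (suc n) k h≈h′ = ∑Words-cong n k (λ w → ∑-cong k (λ i _ → h≈h′ _))

  ∑Words-0 : ∀ n k → ∑Words n k (λ _ → 0#) ≈ 0#
  ∑Words-0 zero    k = refl
  ∑Words-0 (suc n) k = trans (∑Words-cong n k (λ w → ∑-zero k (λ _ _ → refl))) (∑Words-0 n k)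

  ∑Words-+ : ∀ n k (h h′ : List ℕ → Carrier) → ∑Words n k (λ w → h w + h′ w) ≈ ∑Words n k h + ∑Words n k h′
  ∑Words-+ zero    k h h′ = refl
  ∑Words-+ (suc n) k h h′ = trans (∑Words-cong n k (λ w → ∑-+ k _ _)) (∑Words-+ n k _ _)

  ∑Words-∷ : ∀ n k (h : List ℕ → Carrier) → ∑ k (λ a → ∑Words n k (λ w → h (suc a ∷ w))) ≈ ∑Words (suc n) k h
  ∑Words-∷ zero    k h = refl
  ∑Words-∷ (suc n) k h = ∑Words-∷ n k (λ u → ∑ k (λ i → h (u ∷ʳ suc i)))

  sumR-allWords : ∀ n k (h : List ℕ → Carrier) → sumR (map h (allWords n k)) ≈ ∑Words n k h
  sumR-allWords zero    k h = +-identityʳ _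
  sumR-allWords (suc n) k h = begin
    sumR (map h (concatMap (λ a → map (suc a ∷_) (allWords n k)) (upTo k)))
      ≈⟨ sumR-concatMap h _ (upTo k) ⟩
    sumR (map (λ a → sumR (map h (map (suc a ∷_) (allWords n k)))) (upTo k))
      ≈⟨ sumR-map-cong (upTo k) (λ a → trans (reflexive (cong sumR (≡.sym (map-∘ (allWords n k)))))
                                             (sumR-allWords n k (λ w → h (suc a ∷ w)))) ⟩
    sumR (map (λ a → ∑Words n k (λ w → h (suc a ∷ w))) (upTo k))
      ≈⟨ sumR-map-upTo _ k ⟩
    ∑ k (λ a → ∑Words n k (λ w → h (suc a ∷ w)))
      ≈⟨ ∑Words-∷ n k h ⟩
    ∑Words (suc n) k h ∎

  -- A word with maximum j+1 arises from one with maximum j by the letter j+1, or from one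
  -- with maximum j+1 by any of the letters 1, …, j+1.
  ∑-growsTo : ∀ k j → suc j ≤ k → ∀ r m (H : ℕ → Carrier) →
    ∑ k (λ i → if r ∧ growsTo m i (suc j) then H i else 0#)
      ≈ (if r ∧ (m ≡ᵇ j) then H j else 0#) + (if r ∧ (m ≡ᵇ suc j) then ∑ (suc j) H else 0#)
  ∑-growsTo k j j<k false m H = trans (∑-zero k (λ _ _ → refl)) (sym (+-identityʳ 0#))
  ∑-growsTo k j j<k true  m H with ℕ.<-cmp m j
  ... | tri< m<j _ _ rewrite ≡ᵇ-false (ℕ.<⇒≢ m<j) | ≡ᵇ-false (ℕ.<⇒≢ (ℕ.m<n⇒m<1+n m<j)) =
    trans (∑-zero k (λ i _ → reflexive (cong (if_then H i else 0#) (growsTo-< i m<j)))) (sym (+-identityʳ 0#))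
  ... | tri≈ _ ≡.refl _ rewrite ≡ᵇ-refl m | ≡ᵇ-false (ℕ.<⇒≢ (ℕ.n<1+n m)) =
    trans (trans (∑-cong k (λ i _ → reflexive (cong (if_then H i else 0#) (growsTo-max m i)))) (∑-indicator k m H j<k))
          (sym (+-identityʳ _))
  ... | tri> _ _ m>j with ℕ.<-cmp m (suc j)
  ...   | tri< m<1+j _ _ = ⊥-elim (ℕ.<-irrefl ≡.refl (ℕ.<-≤-trans m>j (ℕ.≤-pred m<1+j)))
  ...   | tri≈ _ ≡.refl _ rewrite ≡ᵇ-false (ℕ.>⇒≢ m>j) | ≡ᵇ-refl j =
    trans (trans (∑-cong k (λ i _ → reflexive (cong (if_then H i else 0#) (growsTo-suc j i)))) (∑-prefix k (suc j) H j<k))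
          (sym (+-identityˡ _))
  ...   | tri> _ _ m>1+j rewrite ≡ᵇ-false (ℕ.>⇒≢ m>j) | ≡ᵇ-false (ℕ.>⇒≢ m>1+j) =
    trans (∑-zero k (λ i _ → reflexive (cong (if_then H i else 0#) (growsTo-> i m>1+j)))) (sym (+-identityʳ 0#))

  ∑Words-isPartitionWord : ∀ n k (h : List ℕ → Carrier) j → j ≤ k →
    ∑Words n k (λ w → if isPartitionWord j w then h w else 0#) ≈ ∑RGW n j (λ {w} _ → h w)
  ∑Words-isPartitionWord zero    k h zero    _ = refl
  ∑Words-isPartitionWord zero    k h (suc j) _ = refl
  ∑Words-isPartitionWord (suc n) k h zero    _ =
    trans (∑Words-cong n k (λ w → ∑-zero k (λ i _ → reflexive (cong (if_then h (w ∷ʳ suc i) else 0#) (noBlock w i)))))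
          (∑Words-0 n k)
    where
    noBlock : ∀ w i → isPartitionWord 0 (w ∷ʳ suc i) ≡ false
    noBlock w i = ≡.trans (isPartitionWord-∷ʳ 0 w i)
                          (≡.trans (cong (isRGFfrom 0 w ∧_) (growsTo-zero (maxL w) i)) (∧-zeroʳ _))
  ∑Words-isPartitionWord (suc n) k h (suc j) j<k = begin
    ∑Words n k (λ w → ∑ k (λ i → if isPartitionWord (suc j) (w ∷ʳ suc i) then h (w ∷ʳ suc i) else 0#))
      ≈⟨ ∑Words-cong n k lastLetter ⟩
    ∑Words n k (λ w → (if isPartitionWord j w then h (w ∷ʳ suc j) else 0#)
                      + (if isPartitionWord (suc j) w then ∑ (suc j) (λ i → h (w ∷ʳ suc i)) else 0#))
      ≈⟨ ∑Words-+ n k _ _ ⟩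
    ∑Words n k (λ w → if isPartitionWord j w then h (w ∷ʳ suc j) else 0#)
      + ∑Words n k (λ w → if isPartitionWord (suc j) w then ∑ (suc j) (λ i → h (w ∷ʳ suc i)) else 0#)
      ≈⟨ +-cong (∑Words-isPartitionWord n k (λ w → h (w ∷ʳ suc j)) j (ℕ.<⇒≤ j<k))
                (∑Words-isPartitionWord n k (λ w → ∑ (suc j) (λ i → h (w ∷ʳ suc i))) (suc j) j<k) ⟩
    ∑RGW (suc n) (suc j) (λ {w} _ → h w) ∎
    where
    lastLetter : ∀ w → ∑ k (λ i → if isPartitionWord (suc j) (w ∷ʳ suc i) then h (w ∷ʳ suc i) else 0#)
                       ≈ (if isPartitionWord j w then h (w ∷ʳ suc j) else 0#)
                         + (if isPartitionWord (suc j) w then ∑ (suc j) (λ i → h (w ∷ʳ suc i)) else 0#)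
    lastLetter w = trans
      (∑-cong k (λ i _ → reflexive (cong (if_then h (w ∷ʳ suc i) else 0#) (isPartitionWord-∷ʳ (suc j) w i))))
      (∑-growsTo k j j<k (isRGFfrom 0 w) (maxL w) (λ i → h (w ∷ʳ suc i)))

mainTheorem1 : ∀ {c ℓ : Level} (R : CommutativeSemiring c ℓ)
    (q : CommutativeSemiring.Carrier R) (n k l : ℕ) →
    1 ≤ k → k ≤ n → 1 ≤ l → l ≤ k →
    CommutativeSemiring._≈_ R (QArith.makGen R q n k l) (QArith.Sq R q n k)
mainTheorem1 R q n k l _ _ 1≤l l≤k = begin
  sumR (map F (partitions n k))
    ≈⟨ sumR-filter (isPartitionWord k) F (allWords n k) ⟩
  sumR (map (λ w → if isPartitionWord k w then F w else 0#) (allWords n k))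
    ≈⟨ sumR-allWords n k _ ⟩
  ∑Words n k (λ w → if isPartitionWord k w then F w else 0#)
    ≈⟨ ∑Words-isPartitionWord n k F k ≤-refl ⟩
  ∑RGW n k (λ {w} _ → F w)
    ≈⟨ ∑RGW-cong n k (λ g → reflexive (cong (pow q) (makₗ≡makSet g 1≤l l≤k))) ⟩
  ∑RGW n k (λ g → pow q (makSet g (_≡ᵇ l)))
    ≈⟨ ∑RGW-makSet n k (_≡ᵇ l) ⟩
  Sq q n k ∎
  where
  open CommutativeSemiring R
  open QArith R
  open RangeSum R using (sumR-filter)
  open RGWSum R using (∑RGW; ∑RGW-cong)
  open Enumeration R using (∑Words; sumR-allWords; ∑Words-isPartitionWord)
  open GeneratingFunction R q using (∑RGW-makSet)
  open Words using (makSet; makₗ≡makSet)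
  open import Data.Nat.Properties using (≤-refl)
  open import Relation.Binary.PropositionalEquality using (cong)
  open import Relation.Binary.Reasoning.Setoid setoid
  F : List ℕ → Carrier
  F w = pow q (makₗ k l w)
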